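{- Let $((a_1,\ldots,a_n),(b_1,\ldots,b_m))$ be a bipartite degree sequence that has a realization with matching number $\nu$. Then there is a realization $G$ with partite sets $A=\{v_1,\ldots,v_n\}$ and $B=\{w_1,\ldots,w_m\}$, where $d_G(v_i)=a_i$ for all $i\in[n]$ and $d_G(w_j)=b_j$ for all $j\in[m]$, and an integer $k$ with $0\leq k\leq \nu$ such that (i) $\{ v_iw_{\nu-i+1}:i\in [\nu]\}$ is a maximum matching in $G$, and (ii) $\{ v_i:i\in [k]\}\cup \{ w_j:j\in [\nu-k]\}$ is a minimum vertex cover in $G$.
   Context: All graphs are finite, simple and undirected; $[k]$ denotes $\{1,\ldots,k\}$ (empty if $k\le 0$). For a bipartite graph $G$ with fixed partite sets $A$ and $B$, its bipartite degree sequence is the pair $(d_A,d_B)$ where $d_A$ is the nonincreasing sequence of degrees of the vertices in $A$ and $d_B$ the nonincreasing sequence of degrees of the vertices in $B$. A pair of sequences is a bipartite degree sequence if it is the bipartite degree sequence of some bipartite graph, called a realization of it. The matching number of a graph is the maximum size of a matching; a minimum vertex cover is a smallest set of vertices meeting every edge. -}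

module Defs where

open import Data.Nat using (ℕ; zero; suc; _+_; _≤_; _∸_; _<ᵇ_; _≡ᵇ_)
open import Data.Bool using (Bool; true; false; _∧_; if_then_else_)
open import Data.Fin using (Fin; toℕ) renaming (zero to fzero; suc to fsuc; _≤_ to _≤ᶠ_)
open import Data.Vec using (Vec; lookup)
open import Data.Product using (_×_; Σ; ∃; _,_)
open import Data.Sum using (_⊎_)
open import Relation.Binary.PropositionalEquality using (_≡_)

count : ∀ {n} → (Fin n → Bool) → ℕ
count {zero}  P = 0
count {suc n} P = (if P fzero then 1 else 0) + count (λ i → P (fsuc i))

-- A bipartite graph with partite sets A = {v_0..v_{n-1}} (Fin n) and
-- B = {w_0..w_{m-1}} (Fin m): E i j = true iff v_i w_j is an edge.
-- (Finite, simple, undirected automatically.)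
BipGraph : ℕ → ℕ → Set
BipGraph n m = Fin n → Fin m → Bool

degA : ∀ {n m} → BipGraph n m → Fin n → ℕ
degA E i = count (λ j → E i j)

degB : ∀ {n m} → BipGraph n m → Fin m → ℕ
degB E j = count (λ i → E i j)

Nonincreasing : ∀ {n} → Vec ℕ n → Set
Nonincreasing {n} a = ∀ (i j : Fin n) → i ≤ᶠ j → lookup a j ≤ lookup a i

Realizes : ∀ {n m} → BipGraph n m → Vec ℕ n → Vec ℕ m → Set
Realizes E a b = (∀ i → degA E i ≡ lookup a i) × (∀ j → degB E j ≡ lookup b j)

EdgeSet : ℕ → ℕ → Set
EdgeSet n m = Fin n → Fin m → Bool

sumF : ∀ {n} → (Fin n → ℕ) → ℕ
sumF {zero}  f = 0
sumF {suc n} f = f fzero + sumF (λ i → f (fsuc i))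

size : ∀ {n m} → EdgeSet n m → ℕ
size M = sumF (λ i → count (λ j → M i j))

IsMatching : ∀ {n m} → BipGraph n m → EdgeSet n m → Set
IsMatching E M =
  (∀ i j → M i j ≡ true → E i j ≡ true) ×
  (∀ i j j' → M i j ≡ true → M i j' ≡ true → j ≡ j') ×
  (∀ i i' j → M i j ≡ true → M i' j ≡ true → i ≡ i')

IsMaximumMatching : ∀ {n m} → BipGraph n m → EdgeSet n m → Set
IsMaximumMatching E M =
  IsMatching E M × (∀ M' → IsMatching E M' → size M' ≤ size M)

HasMatchingNumber : ∀ {n m} → BipGraph n m → ℕ → Set
HasMatchingNumber E ν = Σ (EdgeSet _ _) (λ M → IsMaximumMatching E M × size M ≡ ν)

IsVertexCover : ∀ {n m} → BipGraph n m → (Fin n → Bool) → (Fin m → Bool) → Set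
IsVertexCover E CA CB = ∀ i j → E i j ≡ true → (CA i ≡ true ⊎ CB j ≡ true)

IsMinimumVertexCover : ∀ {n m} → BipGraph n m → (Fin n → Bool) → (Fin m → Bool) → Set
IsMinimumVertexCover E CA CB =
  IsVertexCover E CA CB ×
  (∀ CA' CB' → IsVertexCover E CA' CB' → count CA + count CB ≤ count CA' + count CB')

-- With 0-based indices: v_{i+1} ↔ Fin index i, w_{j+1} ↔ Fin index j.
-- { v_i w_{ν-i+1} : i ∈ [ν] }  =  { (i , j) : i < ν , i + j + 1 = ν } (0-based).
antiDiagMatching : ∀ {n m} → ℕ → EdgeSet n m
antiDiagMatching ν i j = (toℕ i <ᵇ ν) ∧ ((toℕ i + toℕ j + 1) ≡ᵇ ν)

-- { v_i : i ∈ [k] } (0-based: indices < k)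
prefixSet : ∀ {n} → ℕ → Fin n → Bool
prefixSet k i = toℕ i <ᵇ k

-- König's theorem gives a maximum matching of size ν together with a vertex cover of size ν, each
-- of whose vertices is matched to a vertex outside the cover. Label the matching edges 0, …, ν − 1,
-- those with their A-end in the cover first, say k of them. Keeping all degrees, and keeping the
-- labelled edges a matching whose chosen ends cover every edge, we move the A-end of edge t to v_t
-- and then its B-end to w_{ν−1−t} (0-based). Every move replaces an endpoint by a vertex of smaller
-- index, hence of at least the same degree, and this is exactly what makes the required 2-switches
-- and neighbourhood exchanges possible. The cover becomes {v_t : t < k} ∪ {w_j : j < ν − k}, and a
-- matching and a vertex cover of equal size are both optimal.

module Submission where

open import Defs
open import Data.Bool using (Bool; true; false; T; not; _∧_; _∨_; _≟_; if_then_else_)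
import Data.Bool.Properties as BP
open import Data.Empty using (⊥-elim)
open import Data.Fin using (Fin; toℕ; fromℕ<; opposite; splitAt; join; _↑ˡ_; _↑ʳ_)
  renaming (zero to fzero; suc to fsuc)
import Data.Fin.Properties as FP
open import Data.Fin.Permutation.Components using (transpose; transpose-inverse)
open import Data.Nat using (ℕ; zero; suc; _+_; _∸_; _≤_; _<_; _<ᵇ_; _≡ᵇ_; z≤n; s≤s; s≤s⁻¹)
import Data.Nat.Properties as NP
open import Algebra.Properties.CommutativeSemigroup NP.+-commutativeSemigroup using (interchange)
open import Data.Product using (Σ; _×_; _,_; proj₁; proj₂)
open import Data.Sum using (_⊎_; inj₁; inj₂)
open import Data.Vec using (Vec)
open import Data.Vec.Functional using (_∷_; updateAt)
open import Data.Vec.Functional.Properties using (updateAt-updates; updateAt-minimal)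
open import Function using (_∘_; const)
open import Relation.Binary.PropositionalEquality
open import Relation.Nullary using (¬_; Dec; yes; no; does)
open import Relation.Nullary.Decidable using (_×-dec_; dec-true)

-- Counting over Fin

bit : Bool → ℕ
bit b = if b then 1 else 0

sumF-cong : ∀ {n} {f g : Fin n → ℕ} → (∀ i → f i ≡ g i) → sumF f ≡ sumF g
sumF-cong {zero}  h = refl
sumF-cong {suc n} h = cong₂ _+_ (h fzero) (sumF-cong (h ∘ fsuc))

sumF-+ : ∀ {n} (f g : Fin n → ℕ) → sumF (λ i → f i + g i) ≡ sumF f + sumF g
sumF-+ {zero}  f g = refl
sumF-+ {suc n} f g = trans (cong (f fzero + g fzero +_) (sumF-+ (f ∘ fsuc) (g ∘ fsuc)))
  (interchange (f fzero) (g fzero) (sumF (f ∘ fsuc)) (sumF (g ∘ fsuc)))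

sumF-mono : ∀ {n} {f g : Fin n → ℕ} → (∀ i → f i ≤ g i) → sumF f ≤ sumF g
sumF-mono {zero}  h = z≤n
sumF-mono {suc n} h = NP.+-mono-≤ (h fzero) (sumF-mono (h ∘ fsuc))

sumF-zero : ∀ {n} → sumF {n} (const 0) ≡ 0
sumF-zero {zero}  = refl
sumF-zero {suc n} = sumF-zero {n}

sumF-swap : ∀ {n m} (h : Fin n → Fin m → ℕ) →
  sumF (λ i → sumF (λ j → h i j)) ≡ sumF (λ j → sumF (λ i → h i j))
sumF-swap {zero}  {m} h = sym (sumF-zero {m})
sumF-swap {suc n} {m} h = trans (cong (sumF (h fzero) +_) (sumF-swap (h ∘ fsuc)))
  (sym (sumF-+ (h fzero) (λ j → sumF (λ i → h (fsuc i) j))))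

sumF-differ-at : ∀ {n} (f g : Fin n → ℕ) q → (∀ i → i ≢ q → f i ≡ g i) →
  sumF f + g q ≡ sumF g + f q
sumF-differ-at {suc n} f g fzero h
  rewrite sumF-cong {f = f ∘ fsuc} {g ∘ fsuc} (λ i → h (fsuc i) λ ()) =
  trans (NP.+-assoc (f fzero) _ (g fzero))
    (trans (NP.+-comm (f fzero) _) (cong (_+ f fzero) (NP.+-comm _ (g fzero))))
sumF-differ-at {suc n} f g (fsuc q) h
  rewrite h fzero (λ ()) =
  trans (NP.+-assoc (g fzero) _ _)
    (trans (cong (g fzero +_) (sumF-differ-at (f ∘ fsuc) (g ∘ fsuc) q (λ i i≢q → h (fsuc i) (i≢q ∘ FP.suc-injective))))
      (sym (NP.+-assoc (g fzero) _ _)))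

count≡sumF : ∀ {n} (f : Fin n → Bool) → count f ≡ sumF (bit ∘ f)
count≡sumF {zero}  f = refl
count≡sumF {suc n} f = cong (bit (f fzero) +_) (count≡sumF (f ∘ fsuc))

count-cong : ∀ {n} {f g : Fin n → Bool} → (∀ i → f i ≡ g i) → count f ≡ count g
count-cong {f = f} {g} h =
  trans (count≡sumF f) (trans (sumF-cong (cong bit ∘ h)) (sym (count≡sumF g)))

count-false : ∀ {n} → count {n} (const false) ≡ 0
count-false {zero}  = refl
count-false {suc n} = count-false {n}

count-+-pointwise : ∀ {n} (f g h k : Fin n → Bool) →
  (∀ i → bit (f i) + bit (g i) ≡ bit (h i) + bit (k i)) → count f + count g ≡ count h + count k
count-+-pointwise f g h k e = begin
  count f + count g                  ≡⟨ cong₂ _+_ (count≡sumF f) (count≡sumF g) ⟩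
  sumF (bit ∘ f) + sumF (bit ∘ g)    ≡⟨ sumF-+ (bit ∘ f) (bit ∘ g) ⟨
  sumF (λ i → bit (f i) + bit (g i)) ≡⟨ sumF-cong e ⟩
  sumF (λ i → bit (h i) + bit (k i)) ≡⟨ sumF-+ (bit ∘ h) (bit ∘ k) ⟩
  sumF (bit ∘ h) + sumF (bit ∘ k)    ≡⟨ cong₂ _+_ (count≡sumF h) (count≡sumF k) ⟨
  count h + count k                  ∎
  where open ≡-Reasoning

count-differ-at : ∀ {n} (f g : Fin n → Bool) q → (∀ i → i ≢ q → f i ≡ g i) →
  count f + bit (g q) ≡ count g + bit (f q)
count-differ-at f g q h = begin
  count f + bit (g q)        ≡⟨ cong (_+ bit (g q)) (count≡sumF f) ⟩
  sumF (bit ∘ f) + bit (g q) ≡⟨ sumF-differ-at (bit ∘ f) (bit ∘ g) q (λ i i≢q → cong bit (h i i≢q)) ⟩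
  sumF (bit ∘ g) + bit (f q) ≡⟨ cong (_+ bit (f q)) (count≡sumF g) ⟨
  count g + bit (f q)        ∎
  where open ≡-Reasoning

count-differ-at₂ : ∀ {n} (f g : Fin n → Bool) p q → p ≢ q → (∀ i → i ≢ p → i ≢ q → f i ≡ g i) →
  bit (f p) + bit (f q) ≡ bit (g p) + bit (g q) → count f ≡ count g
count-differ-at₂ {n} f g p q p≢q h e = NP.+-cancelʳ-≡ _ _ _ (begin
  count f + (bit (f p) + bit (f q))    ≡⟨ cong (count f +_) e ⟩
  count f + (bit (g p) + bit (g q))    ≡⟨ NP.+-assoc (count f) _ _ ⟨
  count f + bit (g p) + bit (g q)      ≡⟨ cong (_+ bit (g q)) at-p ⟩
  count mid + bit (f p) + bit (g q)    ≡⟨ NP.+-assoc (count mid) _ _ ⟩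
  count mid + (bit (f p) + bit (g q))  ≡⟨ cong (count mid +_) (NP.+-comm (bit (f p)) _) ⟩
  count mid + (bit (g q) + bit (f p))  ≡⟨ NP.+-assoc (count mid) _ _ ⟨
  count mid + bit (g q) + bit (f p)    ≡⟨ cong (_+ bit (f p)) at-q ⟩
  count g + bit (f q) + bit (f p)      ≡⟨ NP.+-assoc (count g) _ _ ⟩
  count g + (bit (f q) + bit (f p))    ≡⟨ cong (count g +_) (NP.+-comm (bit (f q)) _) ⟩
  count g + (bit (f p) + bit (f q))    ∎)
  where
  open ≡-Reasoning
  mid : Fin n → Bool
  mid = updateAt f p (const (g p))
  at-p : count f + bit (g p) ≡ count mid + bit (f p)
  at-p = subst (λ b → count f + bit b ≡ count mid + bit (f p)) (updateAt-updates p f)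
    (count-differ-at f mid p (λ i i≢p → sym (updateAt-minimal i p f i≢p)))
  mid≗g : ∀ i → i ≢ q → mid i ≡ g i
  mid≗g i i≢q with i FP.≟ p
  ... | yes refl = updateAt-updates p f
  ... | no i≢p   = trans (updateAt-minimal i p f i≢p) (h i i≢p i≢q)
  at-q : count mid + bit (g q) ≡ count g + bit (f q)
  at-q = subst (λ b → count mid + bit (g q) ≡ count g + bit b) (updateAt-minimal q p f (p≢q ∘ sym))
    (count-differ-at mid g q mid≗g)

true≢false : true ≢ false
true≢false ()

apart : ∀ {A : Set} (f : A → Bool) {x y} → f x ≡ true → f y ≡ false → x ≢ y
apart f fx fy refl = true≢false (trans (sym fx) fy)

count-mono : ∀ {n} (f g : Fin n → Bool) → (∀ i → f i ≡ true → g i ≡ true) → count f ≤ count g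
count-mono {zero}  f g f⊆g = z≤n
count-mono {suc n} f g f⊆g with f fzero in f0 | g fzero in g0
... | true  | true  = s≤s (count-mono _ _ (f⊆g ∘ fsuc))
... | true  | false = ⊥-elim (true≢false (trans (sym (f⊆g fzero f0)) g0))
... | false | true  = NP.m≤n⇒m≤1+n (count-mono _ _ (f⊆g ∘ fsuc))
... | false | false = count-mono _ _ (f⊆g ∘ fsuc)

count-< : ∀ {n} (f g : Fin n → Bool) z → (∀ i → f i ≡ true → g i ≡ true) →
  g z ≡ true → f z ≡ false → count f < count g
count-< {suc n} f g fzero f⊆g gz fz rewrite gz | fz = s≤s (count-mono _ _ (f⊆g ∘ fsuc))
count-< {suc n} f g (fsuc z) f⊆g gz fz with f fzero in f0 | g fzero in g0
... | true  | true  = s≤s (count-< _ _ z (f⊆g ∘ fsuc) gz fz)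
... | true  | false = ⊥-elim (true≢false (trans (sym (f⊆g fzero f0)) g0))
... | false | true  = NP.m≤n⇒m≤1+n (count-< _ _ z (f⊆g ∘ fsuc) gz fz)
... | false | false = count-< _ _ z (f⊆g ∘ fsuc) gz fz

count-pos : ∀ {n} (f : Fin n → Bool) z → f z ≡ true → 1 ≤ count f
count-pos {n} f z fz =
  subst (λ c → suc c ≤ count f) (count-false {n}) (count-< (const false) f z (λ _ ()) fz refl)

count≤n : ∀ {n} (f : Fin n → Bool) → count f ≤ n
count≤n {zero}  f = z≤n
count≤n {suc n} f with f fzero
... | true  = s≤s (count≤n _)
... | false = NP.m≤n⇒m≤1+n (count≤n _)

count<n : ∀ {n} (f : Fin n → Bool) z → f z ≡ false → count f < n
count<n {suc n} f fzero fz rewrite fz = s≤s (count≤n _)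
count<n {suc n} f (fsuc z) fz with f fzero
... | true  = s≤s (count<n _ z fz)
... | false = NP.m≤n⇒m≤1+n (count<n _ z fz)

count≤1 : ∀ {n} (f : Fin n → Bool) → (∀ i j → f i ≡ true → f j ≡ true → i ≡ j) → count f ≤ 1
count≤1 {zero}  f unique = z≤n
count≤1 {suc n} f unique with f fzero in f0
... | true  = NP.≤-reflexive (cong suc (trans (count-cong rest-false) (count-false {n})))
  where
  rest-false : ∀ i → f (fsuc i) ≡ false
  rest-false i with f (fsuc i) in fi
  ... | true  = ⊥-elim (FP.0≢1+n (sym (unique _ _ fi f0)))
  ... | false = refl
... | false = count≤1 _ (λ i j fi fj → FP.suc-injective (unique _ _ fi fj))

count-unique : ∀ {n} (f : Fin n → Bool) i → f i ≡ true → (∀ j → j ≢ i → f j ≡ false) → count f ≡ 1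
count-unique {n} f i fi others = NP.+-cancelʳ-≡ 0 _ _
  (trans (count-differ-at f (const false) i others) (cong₂ (λ c b → c + bit b) (count-false {n}) fi))

count-split : ∀ {n} (f g : Fin n → Bool) → count f ≡ count (λ i → f i ∧ g i) + count (λ i → f i ∧ not (g i))
count-split {n} f g = begin
  count f                       ≡⟨ NP.+-identityʳ (count f) ⟨
  count f + 0                   ≡⟨ cong (count f +_) (count-false {n}) ⟨
  count f + count {n} (const false) ≡⟨ count-+-pointwise f (const false) _ _ bits ⟩
  count (λ i → f i ∧ g i) + count (λ i → f i ∧ not (g i)) ∎
  where
  open ≡-Reasoning
  bits : ∀ i → bit (f i) + 0 ≡ bit (f i ∧ g i) + bit (f i ∧ not (g i))
  bits i with f i | g i
  ... | true  | true  = refl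
  ... | true  | false = refl
  ... | false | _     = refl

count-prefix : ∀ {n} k → k ≤ n → count (prefixSet {n} k) ≡ k
count-prefix {zero}  zero    _         = refl
count-prefix {suc n} zero    _         = count-false {n}
count-prefix {suc n} (suc k) (s≤s k≤n) = cong suc (count-prefix {n} k k≤n)

module _ {ν} (k : ℕ) (i : Fin ν) where
  prefixSet⇒< : prefixSet k i ≡ true → toℕ i < k
  prefixSet⇒< e = NP.<ᵇ⇒< (toℕ i) k (subst T (sym e) _)

  prefixSet-false⇒≥ : prefixSet k i ≡ false → k ≤ toℕ i
  prefixSet-false⇒≥ e = NP.≮⇒≥ λ i<k → subst T e (NP.<⇒<ᵇ i<k)

  ≥⇒prefixSet-false : k ≤ toℕ i → prefixSet k i ≡ false
  ≥⇒prefixSet-false k≤i with prefixSet k i in e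
  ... | true  = ⊥-elim (NP.<⇒≱ (prefixSet⇒< e) k≤i)
  ... | false = refl

  <⇒prefixSet : toℕ i < k → prefixSet k i ≡ true
  <⇒prefixSet i<k with prefixSet k i in e
  ... | true  = refl
  ... | false = ⊥-elim (NP.<⇒≱ i<k (prefixSet-false⇒≥ e))

prefix-order : ∀ {ν} k (s t : Fin ν) → toℕ s < toℕ t → prefixSet k s ≢ prefixSet k t →
  prefixSet k s ≡ true × prefixSet k t ≡ false
prefix-order k s t s<t differ with prefixSet k s in s∈ | prefixSet k t in t∈
... | true  | false = refl , refl
... | true  | true  = ⊥-elim (differ refl)
... | false | false = ⊥-elim (differ refl)
... | false | true  = ⊥-elim (NP.<-irrefl refl
      (NP.<-≤-trans (prefixSet⇒< k t t∈) (NP.≤-trans (prefixSet-false⇒≥ k s s∈) (NP.<⇒≤ s<t))))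

subset-of-count : ∀ {n} (P : Fin n → Bool) s → s ≤ count P →
  Σ (Fin n → Bool) λ Q → (∀ i → Q i ≡ true → P i ≡ true) × count Q ≡ s
subset-of-count {zero} P zero _ = const false , (λ _ ()) , refl
subset-of-count {suc n} P s s≤ with P fzero in P0
subset-of-count {suc n} P zero _ | true = const false , (λ _ ()) , count-false {suc n}
subset-of-count {suc n} P (suc s) (s≤s s≤) | true with subset-of-count (P ∘ fsuc) s s≤
... | Q , Q⊆P , count-Q = (true ∷ Q) , ⊆P , cong suc count-Q
  where
  ⊆P : ∀ i → (true ∷ Q) i ≡ true → P i ≡ true
  ⊆P fzero    _ = P0
  ⊆P (fsuc i) q = Q⊆P i q
subset-of-count {suc n} P s s≤ | false with subset-of-count (P ∘ fsuc) s s≤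
... | Q , Q⊆P , count-Q = (false ∷ Q) , ⊆P , count-Q
  where
  ⊆P : ∀ i → (false ∷ Q) i ≡ true → P i ≡ true
  ⊆P fzero    ()
  ⊆P (fsuc i) q = Q⊆P i q

surplus-witness : ∀ {n} (f g : Fin n → Bool) z → count g ≤ count f → g z ≡ true → f z ≡ false →
  Σ (Fin n) λ c → f c ≡ true × g c ≡ false
surplus-witness f g z g≤f gz fz with FP.any? (λ c → (f c ≟ true) ×-dec (g c ≟ false))
... | yes (c , fc , gc) = c , fc , gc
... | no none = ⊥-elim (NP.<⇒≱ (count-< f g z f⊆g gz fz) g≤f)
  where
  f⊆g : ∀ c → f c ≡ true → g c ≡ true
  f⊆g c fc = BP.¬-not (λ gc → none (c , fc , gc))

enumerate : ∀ {n} (P : Fin n → Bool) → Fin (count P) → Fin n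
enumerate {suc n} P = go (P fzero)
  where
  go : ∀ b → Fin (bit b + count (P ∘ fsuc)) → Fin (suc n)
  go true  fzero    = fzero
  go true  (fsuc t) = fsuc (enumerate (P ∘ fsuc) t)
  go false t        = fsuc (enumerate (P ∘ fsuc) t)

enumerate-sound : ∀ {n} (P : Fin n → Bool) t → P (enumerate P t) ≡ true
enumerate-sound {suc n} P t with P fzero in P0
enumerate-sound {suc n} P fzero    | true = P0
enumerate-sound {suc n} P (fsuc t) | true = enumerate-sound (P ∘ fsuc) t
enumerate-sound {suc n} P t        | false = enumerate-sound (P ∘ fsuc) t

enumerate-injective : ∀ {n} (P : Fin n → Bool) {s t} → enumerate P s ≡ enumerate P t → s ≡ t
enumerate-injective {suc n} P {s} {t} eq with P fzero
enumerate-injective {suc n} P {fzero}  {fzero}  eq | true = refl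
enumerate-injective {suc n} P {fsuc s} {fsuc t} eq | true =
  cong fsuc (enumerate-injective (P ∘ fsuc) (FP.suc-injective eq))
enumerate-injective {suc n} P {s} {t} eq | false = enumerate-injective (P ∘ fsuc) (FP.suc-injective eq)

enumerate-complete : ∀ {n} (P : Fin n → Bool) i → P i ≡ true → Σ (Fin (count P)) λ t → enumerate P t ≡ i
enumerate-complete {suc n} P i Pi with P fzero in P0
enumerate-complete {suc n} P fzero    Pi | true = fzero , refl
enumerate-complete {suc n} P (fsuc i) Pi | true with enumerate-complete (P ∘ fsuc) i Pi
... | t , eq = fsuc t , cong fsuc eq
enumerate-complete {suc n} P fzero    Pi | false = ⊥-elim (true≢false (trans (sym Pi) P0))
enumerate-complete {suc n} P (fsuc i) Pi | false with enumerate-complete (P ∘ fsuc) i Pi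
... | t , eq = t , cong fsuc eq

insert : ∀ {n} → (Fin n → Bool) → Fin n → Fin n → Bool
insert f z = updateAt f z (const true)

module _ {n} (f : Fin n → Bool) (z : Fin n) where
  insert-here : insert f z z ≡ true
  insert-here = updateAt-updates z f

  insert-⊇ : ∀ x → f x ≡ true → insert f z x ≡ true
  insert-⊇ x fx with x FP.≟ z
  ... | yes refl = insert-here
  ... | no x≢z   = trans (updateAt-minimal x z f x≢z) fx

  insert-cases : ∀ x → insert f z x ≡ true → f x ≡ true ⊎ x ≡ z
  insert-cases x fx with x FP.≟ z
  ... | yes x≡z = inj₂ x≡z
  ... | no x≢z  = inj₁ (trans (sym (updateAt-minimal x z f x≢z)) fx)

  count-insert : f z ≡ false → count (insert f z) ≡ suc (count f)
  count-insert fz = NP.+-cancelʳ-≡ 0 _ _ (begin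
    count (insert f z) + 0           ≡⟨ cong (λ b → count (insert f z) + bit b) fz ⟨
    count (insert f z) + bit (f z)   ≡⟨ count-differ-at f (insert f z) z (λ x x≢z → sym (updateAt-minimal x z f x≢z)) ⟨
    count f + bit (insert f z z)     ≡⟨ cong (λ b → count f + bit b) insert-here ⟩
    count f + 1                      ≡⟨ NP.+-comm (count f) 1 ⟩
    suc (count f)                    ≡⟨ NP.+-identityʳ _ ⟨
    suc (count f) + 0                ∎)
    where open ≡-Reasoning

remove : ∀ {n} → (Fin n → Bool) → Fin n → Fin n → Bool
remove f z = updateAt f z (const false)

module _ {n} (f : Fin n → Bool) (z : Fin n) where
  remove-here : remove f z z ≡ false
  remove-here = updateAt-updates z f

  remove-⊆ : ∀ x → remove f z x ≡ true → f x ≡ true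
  remove-⊆ x fx with x FP.≟ z
  ... | yes refl = ⊥-elim (true≢false (trans (sym fx) (updateAt-updates z f)))
  ... | no x≢z   = trans (sym (updateAt-minimal x z f x≢z)) fx

  count-remove : f z ≡ true → count f ≡ suc (count (remove f z))
  count-remove fz = NP.+-cancelʳ-≡ 0 _ _ (begin
    count f + 0                     ≡⟨ cong (λ b → count f + bit b) (updateAt-updates z f) ⟨
    count f + bit (remove f z z)    ≡⟨ count-differ-at f (remove f z) z (λ x x≢z → sym (updateAt-minimal x z f x≢z)) ⟩
    count (remove f z) + bit (f z)  ≡⟨ cong (λ b → count (remove f z) + bit b) fz ⟩
    count (remove f z) + 1          ≡⟨ NP.+-comm (count (remove f z)) 1 ⟩
    suc (count (remove f z))        ≡⟨ NP.+-identityʳ _ ⟨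
    suc (count (remove f z)) + 0    ∎)
    where open ≡-Reasoning

-- Matchings and vertex covers

matching≤cover : ∀ {n m} (E : BipGraph n m) (M : EdgeSet n m) CA CB →
  IsMatching E M → IsVertexCover E CA CB → size M ≤ count CA + count CB
matching≤cover {n} {m} E M CA CB (M⊆E , row-unique , col-unique) cover = begin
  size M                                                    ≤⟨ sumF-mono row-bound ⟩
  sumF (λ i → bit (CA i) + count (λ j → M i j ∧ CB j))      ≡⟨ sumF-+ (bit ∘ CA) _ ⟩
  sumF (bit ∘ CA) + sumF (λ i → count (λ j → M i j ∧ CB j)) ≡⟨ cong₂ _+_ (sym (count≡sumF CA)) swapped ⟩
  count CA + sumF (λ j → count (λ i → M i j ∧ CB j))        ≤⟨ NP.+-monoʳ-≤ (count CA) (sumF-mono col-bound) ⟩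
  count CA + sumF (bit ∘ CB)                                ≡⟨ cong (count CA +_) (count≡sumF CB) ⟨
  count CA + count CB                                       ∎
  where
  open NP.≤-Reasoning
  row-bound : ∀ i → count (M i) ≤ bit (CA i) + count (λ j → M i j ∧ CB j)
  row-bound i with CA i in CAi
  ... | true  = NP.≤-trans (count≤1 (M i) (row-unique i)) (NP.m≤m+n 1 _)
  ... | false = count-mono _ _ M⊆CB
    where
    M⊆CB : ∀ j → M i j ≡ true → (M i j ∧ CB j) ≡ true
    M⊆CB j Mij with cover i j (M⊆E i j Mij)
    ... | inj₁ CAi′ = ⊥-elim (true≢false (trans (sym CAi′) CAi))
    ... | inj₂ CBj rewrite Mij | CBj = refl
  swapped : sumF (λ i → count (λ j → M i j ∧ CB j)) ≡ sumF (λ j → count (λ i → M i j ∧ CB j))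
  swapped = trans (sumF-cong (λ i → count≡sumF (λ j → M i j ∧ CB j)))
    (trans (sumF-swap (λ i j → bit (M i j ∧ CB j))) (sumF-cong (λ j → sym (count≡sumF (λ i → M i j ∧ CB j)))))
  col-bound : ∀ j → count (λ i → M i j ∧ CB j) ≤ bit (CB j)
  col-bound j with CB j
  ... | true  = count≤1 _ (λ i i′ Mij Mi′j →
                  col-unique i i′ j (trans (sym (BP.∧-identityʳ _)) Mij) (trans (sym (BP.∧-identityʳ _)) Mi′j))
  ... | false = NP.≤-reflexive (trans (count-cong (λ i → BP.∧-zeroʳ (M i j))) (count-false {n}))

cover≤matching : ∀ {n m} (M : EdgeSet n m) (CA : Fin n → Bool) (CB : Fin m → Bool) →
  (∀ i → CA i ≡ true → Σ (Fin m) λ j → M i j ≡ true) →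
  (∀ j → CB j ≡ true → Σ (Fin n) λ i → M i j ≡ true × CA i ≡ false) →
  count CA + count CB ≤ size M
cover≤matching {n} {m} M CA CB CA-matched CB-matched = begin
  count CA + count CB                ≤⟨ NP.+-monoʳ-≤ (count CA) CB-bound ⟩
  count CA + sumF outside            ≡⟨ cong (_+ sumF outside) (count≡sumF CA) ⟩
  sumF (bit ∘ CA) + sumF outside     ≡⟨ sumF-+ (bit ∘ CA) outside ⟨
  sumF (λ i → bit (CA i) + outside i) ≤⟨ sumF-mono row-bound ⟩
  size M                             ∎
  where
  open NP.≤-Reasoning
  outside : Fin n → ℕ
  outside i = count (λ j → M i j ∧ not (CA i))
  row-bound : ∀ i → bit (CA i) + outside i ≤ count (M i)
  row-bound i with CA i in CAi
  ... | true  with CA-matched i CAi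
  ...   | j , Mij = subst (_≤ count (M i))
                      (cong suc (sym (trans (count-cong (λ j → BP.∧-zeroʳ (M i j))) (count-false {m}))))
                      (count-pos (M i) j Mij)
  row-bound i | false = NP.≤-reflexive (count-cong (λ j → BP.∧-identityʳ (M i j)))
  col-bound : ∀ j → bit (CB j) ≤ count (λ i → M i j ∧ not (CA i))
  col-bound j with CB j in CBj
  ... | false = z≤n
  ... | true with CB-matched j CBj
  ...   | i , Mij , CAi = count-pos _ i (subst₂ (λ x y → (x ∧ not y) ≡ true) (sym Mij) (sym CAi) refl)
  CB-bound : count CB ≤ sumF outside
  CB-bound = begin
    count CB                                            ≡⟨ count≡sumF CB ⟩
    sumF (bit ∘ CB)                                     ≤⟨ sumF-mono col-bound ⟩
    sumF (λ j → count (λ i → M i j ∧ not (CA i)))       ≡⟨ sumF-cong (λ j → count≡sumF (λ i → M i j ∧ not (CA i))) ⟩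
    sumF (λ j → sumF (λ i → bit (M i j ∧ not (CA i))))  ≡⟨ sumF-swap (λ i j → bit (M i j ∧ not (CA i))) ⟨
    sumF (λ i → sumF (λ j → bit (M i j ∧ not (CA i))))  ≡⟨ sumF-cong (λ i → sym (count≡sumF (λ j → M i j ∧ not (CA i)))) ⟩
    sumF outside                                        ∎

setEdge : ∀ {n m} → EdgeSet n m → Fin n → Fin m → Bool → EdgeSet n m
setEdge E i₀ j₀ v = updateAt E i₀ (λ row → updateAt row j₀ (const v))

module _ {n m} (E : EdgeSet n m) (i₀ : Fin n) (j₀ : Fin m) (v : Bool) where
  setEdge-here : setEdge E i₀ j₀ v i₀ j₀ ≡ v
  setEdge-here = trans (cong-app (updateAt-updates i₀ E) j₀) (updateAt-updates j₀ (E i₀))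

  setEdge-otherRow : ∀ i j → i ≢ i₀ → setEdge E i₀ j₀ v i j ≡ E i j
  setEdge-otherRow i j i≢i₀ = cong-app (updateAt-minimal i i₀ E i≢i₀) j

  setEdge-otherCol : ∀ i j → j ≢ j₀ → setEdge E i₀ j₀ v i j ≡ E i j
  setEdge-otherCol i j j≢j₀ with i FP.≟ i₀
  ... | yes refl = trans (cong-app (updateAt-updates i₀ E) j) (updateAt-minimal j j₀ (E i₀) j≢j₀)
  ... | no i≢i₀  = setEdge-otherRow i j i≢i₀

  setEdge-cases : ∀ i j → (i ≡ i₀ × j ≡ j₀) ⊎ setEdge E i₀ j₀ v i j ≡ E i j
  setEdge-cases i j with i FP.≟ i₀ | j FP.≟ j₀
  ... | yes i≡i₀ | yes j≡j₀ = inj₁ (i≡i₀ , j≡j₀)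
  ... | yes _    | no j≢j₀  = inj₂ (setEdge-otherCol i j j≢j₀)
  ... | no i≢i₀  | _        = inj₂ (setEdge-otherRow i j i≢i₀)

  size-setEdge : size (setEdge E i₀ j₀ v) + bit (E i₀ j₀) ≡ size E + bit v
  size-setEdge = NP.+-cancelʳ-≡ (count (E i₀)) _ _ (begin
    size E′ + bit (E i₀ j₀) + count (E i₀)   ≡⟨ NP.+-assoc (size E′) _ _ ⟩
    size E′ + (bit (E i₀ j₀) + count (E i₀)) ≡⟨ cong (size E′ +_) (NP.+-comm (bit (E i₀ j₀)) _) ⟩
    size E′ + (count (E i₀) + bit (E i₀ j₀)) ≡⟨ NP.+-assoc (size E′) _ _ ⟨
    size E′ + count (E i₀) + bit (E i₀ j₀)   ≡⟨ cong (_+ bit (E i₀ j₀)) rows ⟨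
    size E + count (E′ i₀) + bit (E i₀ j₀)   ≡⟨ NP.+-assoc (size E) _ _ ⟩
    size E + (count (E′ i₀) + bit (E i₀ j₀)) ≡⟨ cong (size E +_) row-i₀ ⟨
    size E + (count (E i₀) + bit v)          ≡⟨ cong (size E +_) (NP.+-comm (count (E i₀)) _) ⟩
    size E + (bit v + count (E i₀))          ≡⟨ NP.+-assoc (size E) _ _ ⟨
    size E + bit v + count (E i₀)            ∎)
    where
    open ≡-Reasoning
    E′ : EdgeSet n m
    E′ = setEdge E i₀ j₀ v
    rows : size E + count (E′ i₀) ≡ size E′ + count (E i₀)
    rows = sumF-differ-at (count ∘ E) (count ∘ E′) i₀ (λ i i≢i₀ → count-cong (λ j → sym (setEdge-otherRow i j i≢i₀)))
    row-i₀ : count (E i₀) + bit v ≡ count (E′ i₀) + bit (E i₀ j₀)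
    row-i₀ = subst (λ b → count (E i₀) + bit b ≡ count (E′ i₀) + bit (E i₀ j₀)) setEdge-here
      (count-differ-at (E i₀) (E′ i₀) j₀ (λ j j≢j₀ → sym (setEdge-otherCol i₀ j j≢j₀)))

-- König's theorem

record TightCover {n m} (H : BipGraph n m) (M : EdgeSet n m) : Set where
  field
    coverA : Fin n → Bool
    coverB : Fin m → Bool
    isCover : IsVertexCover H coverA coverB
    coverA-matched : ∀ i → coverA i ≡ true → Σ (Fin m) λ j → M i j ≡ true × coverB j ≡ false
    coverB-matched : ∀ j → coverB j ≡ true → Σ (Fin n) λ i → M i j ≡ true × coverA i ≡ false

  size-coverA+coverB : IsMatching H M → count coverA + count coverB ≡ size M
  size-coverA+coverB isM = NP.≤-antisym
    (cover≤matching M coverA coverB (λ i ci → let (j , Mij , _) = coverA-matched i ci in j , Mij) coverB-matched)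
    (matching≤cover H M coverA coverB isM isCover)

-- ZA and ZB play the vertices reachable from unmatched A-vertices by M-alternating paths; instead of
-- the paths we keep, for each reached i ∈ ZA, a matching as large as M that leaves i unmatched and
-- differs from M only in columns of ZB.
module König {n m} (H : BipGraph n m) (M : EdgeSet n m) (isM : IsMatching H M)
  (maxM : ∀ M′ → IsMatching H M′ → size M′ ≤ size M) where

  M-col-unique : ∀ i i′ j → M i j ≡ true → M i′ j ≡ true → i ≡ i′
  M-col-unique = proj₂ (proj₂ isM)

  record Unmatching (ZB : Fin m → Bool) (i : Fin n) : Set where
    field
      matching : EdgeSet n m
      isMatching : IsMatching H matching
      same-size : size matching ≡ size M
      agrees : ∀ i′ j → matching i′ j ≢ M i′ j → ZB j ≡ true
      leaves-free : ∀ j → matching i j ≡ false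

  record Reached : Set where
    field
      ZA : Fin n → Bool
      ZB : Fin m → Bool
      unmatched∈ZA : ∀ i → (∀ j → M i j ≡ false) → ZA i ≡ true
      partner∈ZA : ∀ i j → ZB j ≡ true → M i j ≡ true → ZA i ≡ true
      ZB-matched : ∀ j → ZB j ≡ true → Σ (Fin n) λ i → M i j ≡ true
      unmatching : ∀ i → ZA i ≡ true → Unmatching ZB i
  open Reached

  closed⇒tightCover : (R : Reached) → (∀ i j → ZA R i ≡ true → H i j ≡ true → ZB R j ≡ true) → TightCover H M
  closed⇒tightCover R closed = record
    { coverA = not ∘ ZA R ; coverB = ZB R ; isCover = isCover
    ; coverA-matched = coverA-matched ; coverB-matched = coverB-matched }
    where
    isCover : IsVertexCover H (not ∘ ZA R) (ZB R)
    isCover i j Hij with ZA R i in i∈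
    ... | true  = inj₂ (closed i j i∈ Hij)
    ... | false = inj₁ refl
    coverA-matched : ∀ i → not (ZA R i) ≡ true → Σ (Fin m) λ j → M i j ≡ true × ZB R j ≡ false
    coverA-matched i i∉ with ZA R i in i∉ZA
    ... | true  = ⊥-elim (true≢false (sym i∉))
    ... | false with FP.any? (λ j → M i j ≟ true)
    ...   | yes (j , Mij) = j , Mij , BP.¬-not (λ j∈ → true≢false (trans (sym (partner∈ZA R i j j∈ Mij)) i∉ZA))
    ...   | no unmatched  =
      ⊥-elim (true≢false (trans (sym (unmatched∈ZA R i λ j → BP.¬-not λ Mij → unmatched (j , Mij))) i∉ZA))
    coverB-matched : ∀ j → ZB R j ≡ true → Σ (Fin n) λ i → M i j ≡ true × not (ZA R i) ≡ false
    coverB-matched j j∈ with ZB-matched R j j∈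
    ... | i , Mij = i , Mij , cong not (partner∈ZA R i j j∈ Mij)

  -- If b₀ were free in M, hence in M₁, then M₁ + a b₀ would beat M; so b₀ has a partner a₂ in M,
  -- and M₁ + a b₀ − a₂ b₀ leaves a₂ free.
  module Grow (R : Reached) (a : Fin n) (b₀ : Fin m) (a∈ : ZA R a ≡ true) (Hab₀ : H a b₀ ≡ true)
              (b₀∉ : ZB R b₀ ≡ false) where
    open Unmatching (unmatching R a a∈) renaming (matching to M₁; isMatching to M₁-matching)

    M₁-col-b₀ : ∀ i → M₁ i b₀ ≡ M i b₀
    M₁-col-b₀ i with M₁ i b₀ ≟ M i b₀
    ... | yes eq = eq
    ... | no ne  = ⊥-elim (true≢false (trans (sym (agrees i b₀ ne)) b₀∉))

    M⁺ : EdgeSet n m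
    M⁺ = setEdge M₁ a b₀ true

    size-M⁺ : size M⁺ ≡ suc (size M)
    size-M⁺ = begin
      size M⁺                       ≡⟨ NP.+-identityʳ _ ⟨
      size M⁺ + bit false           ≡⟨ cong (λ b → size M⁺ + bit b) (leaves-free b₀) ⟨
      size M⁺ + bit (M₁ a b₀)       ≡⟨ size-setEdge M₁ a b₀ true ⟩
      size M₁ + 1                   ≡⟨ NP.+-comm (size M₁) 1 ⟩
      suc (size M₁)                 ≡⟨ cong suc same-size ⟩
      suc (size M)                  ∎
      where open ≡-Reasoning

    M⁺-cases : ∀ i j → M⁺ i j ≡ true → (i ≡ a × j ≡ b₀) ⊎ M₁ i j ≡ true
    M⁺-cases i j M⁺ij with setEdge-cases M₁ a b₀ true i j
    ... | inj₁ here = inj₁ here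
    ... | inj₂ eq   = inj₂ (trans (sym eq) M⁺ij)

    b₀-matched : Σ (Fin n) λ a₂ → M a₂ b₀ ≡ true
    b₀-matched with FP.any? (λ i → M i b₀ ≟ true)
    ... | yes found = found
    ... | no none = ⊥-elim (NP.<-irrefl refl (NP.<-≤-trans (NP.≤-reflexive (sym size-M⁺)) (maxM M⁺ M⁺-matching)))
      where
      b₀-free : ∀ i → M₁ i b₀ ≡ false
      b₀-free i = trans (M₁-col-b₀ i) (BP.¬-not (λ Mib₀ → none (i , Mib₀)))
      M⁺-matching : IsMatching H M⁺
      M⁺-matching = ⊆H , row-unique , col-unique
        where
        ⊆H : ∀ i j → M⁺ i j ≡ true → H i j ≡ true
        ⊆H i j e with M⁺-cases i j e
        ... | inj₁ (refl , refl) = Hab₀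
        ... | inj₂ M₁ij = proj₁ M₁-matching i j M₁ij
        row-unique : ∀ i j j′ → M⁺ i j ≡ true → M⁺ i j′ ≡ true → j ≡ j′
        row-unique i j j′ e e′ with M⁺-cases i j e | M⁺-cases i j′ e′
        ... | inj₁ (refl , refl) | inj₁ (_ , refl) = refl
        ... | inj₁ (refl , refl) | inj₂ M₁ij′ = ⊥-elim (true≢false (trans (sym M₁ij′) (leaves-free j′)))
        ... | inj₂ M₁ij | inj₁ (refl , refl) = ⊥-elim (true≢false (trans (sym M₁ij) (leaves-free j)))
        ... | inj₂ M₁ij | inj₂ M₁ij′ = proj₁ (proj₂ M₁-matching) i j j′ M₁ij M₁ij′
        col-unique : ∀ i i′ j → M⁺ i j ≡ true → M⁺ i′ j ≡ true → i ≡ i′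
        col-unique i i′ j e e′ with M⁺-cases i j e | M⁺-cases i′ j e′
        ... | inj₁ (refl , refl) | inj₁ (refl , _) = refl
        ... | inj₁ (refl , refl) | inj₂ M₁i′j = ⊥-elim (true≢false (trans (sym M₁i′j) (b₀-free i′)))
        ... | inj₂ M₁ij | inj₁ (refl , refl) = ⊥-elim (true≢false (trans (sym M₁ij) (b₀-free i)))
        ... | inj₂ M₁ij | inj₂ M₁i′j = proj₂ (proj₂ M₁-matching) i i′ j M₁ij M₁i′j

    a₂ : Fin n
    a₂ = proj₁ b₀-matched

    Ma₂b₀ : M a₂ b₀ ≡ true
    Ma₂b₀ = proj₂ b₀-matched

    M₁a₂b₀ : M₁ a₂ b₀ ≡ true
    M₁a₂b₀ = trans (M₁-col-b₀ a₂) Ma₂b₀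

    a≢a₂ : a ≢ a₂
    a≢a₂ a≡a₂ = true≢false (trans (sym M₁a₂b₀) (trans (cong (λ i → M₁ i b₀) (sym a≡a₂)) (leaves-free b₀)))

    M′ : EdgeSet n m
    M′ = setEdge M⁺ a₂ b₀ false

    M′-cases : ∀ i j → M′ i j ≡ true → (i ≡ a × j ≡ b₀) ⊎ (M₁ i j ≡ true × j ≢ b₀)
    M′-cases i j M′ij with setEdge-cases M⁺ a₂ b₀ false i j
    ... | inj₁ (refl , refl) = ⊥-elim (true≢false (trans (sym M′ij) (setEdge-here M⁺ a₂ b₀ false)))
    ... | inj₂ eq with M⁺-cases i j (trans (sym eq) M′ij)
    ...   | inj₁ here = inj₁ here
    ...   | inj₂ M₁ij = inj₂ (M₁ij , j≢b₀)
      where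
      j≢b₀ : j ≢ b₀
      j≢b₀ refl with M-col-unique i a₂ b₀ (trans (sym (M₁-col-b₀ i)) M₁ij) Ma₂b₀
      ... | refl = true≢false (trans (sym M′ij) (setEdge-here M⁺ a₂ b₀ false))

    M′-matching : IsMatching H M′
    M′-matching = ⊆H , row-unique , col-unique
      where
      ⊆H : ∀ i j → M′ i j ≡ true → H i j ≡ true
      ⊆H i j e with M′-cases i j e
      ... | inj₁ (refl , refl) = Hab₀
      ... | inj₂ (M₁ij , _) = proj₁ M₁-matching i j M₁ij
      row-unique : ∀ i j j′ → M′ i j ≡ true → M′ i j′ ≡ true → j ≡ j′
      row-unique i j j′ e e′ with M′-cases i j e | M′-cases i j′ e′
      ... | inj₁ (refl , refl) | inj₁ (_ , refl) = refl
      ... | inj₁ (refl , refl) | inj₂ (M₁ij′ , _) = ⊥-elim (true≢false (trans (sym M₁ij′) (leaves-free j′)))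
      ... | inj₂ (M₁ij , _) | inj₁ (refl , refl) = ⊥-elim (true≢false (trans (sym M₁ij) (leaves-free j)))
      ... | inj₂ (M₁ij , _) | inj₂ (M₁ij′ , _) = proj₁ (proj₂ M₁-matching) i j j′ M₁ij M₁ij′
      col-unique : ∀ i i′ j → M′ i j ≡ true → M′ i′ j ≡ true → i ≡ i′
      col-unique i i′ j e e′ with M′-cases i j e | M′-cases i′ j e′
      ... | inj₁ (refl , refl) | inj₁ (refl , _) = refl
      ... | inj₁ (refl , refl) | inj₂ (_ , j≢b₀) = ⊥-elim (j≢b₀ refl)
      ... | inj₂ (_ , j≢b₀) | inj₁ (refl , refl) = ⊥-elim (j≢b₀ refl)
      ... | inj₂ (M₁ij , _) | inj₂ (M₁i′j , _) = proj₂ (proj₂ M₁-matching) i i′ j M₁ij M₁i′j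

    size-M′ : size M′ ≡ size M
    size-M′ = NP.+-cancelʳ-≡ 1 _ _ (begin
      size M′ + 1                 ≡⟨ cong (λ b → size M′ + bit b) M⁺a₂b₀ ⟨
      size M′ + bit (M⁺ a₂ b₀)    ≡⟨ size-setEdge M⁺ a₂ b₀ false ⟩
      size M⁺ + 0                 ≡⟨ NP.+-identityʳ _ ⟩
      size M⁺                     ≡⟨ size-M⁺ ⟩
      suc (size M)                ≡⟨ NP.+-comm 1 (size M) ⟩
      size M + 1                  ∎)
      where
      open ≡-Reasoning
      M⁺a₂b₀ : M⁺ a₂ b₀ ≡ true
      M⁺a₂b₀ = trans (setEdge-otherRow M₁ a b₀ true a₂ b₀ (a≢a₂ ∘ sym)) M₁a₂b₀

    a₂-free : ∀ j → M′ a₂ j ≡ false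
    a₂-free j = BP.¬-not a₂j-absent
      where
      a₂j-absent : M′ a₂ j ≢ true
      a₂j-absent e with M′-cases a₂ j e
      ... | inj₁ (a₂≡a , _) = a≢a₂ (sym a₂≡a)
      ... | inj₂ (M₁a₂j , j≢b₀) = j≢b₀ (proj₁ (proj₂ M₁-matching) a₂ j b₀ M₁a₂j M₁a₂b₀)

    ZA′ : Fin n → Bool
    ZA′ = insert (ZA R) a₂

    ZB′ : Fin m → Bool
    ZB′ = insert (ZB R) b₀

    M′-agrees : ∀ i j → M′ i j ≢ M i j → ZB′ j ≡ true
    M′-agrees i j ne with j FP.≟ b₀
    ... | yes refl = insert-here (ZB R) b₀
    ... | no j≢b₀  = insert-⊇ (ZB R) b₀ j (agrees i j λ eq → ne (begin
      M′ i j  ≡⟨ setEdge-otherCol M⁺ a₂ b₀ false i j j≢b₀ ⟩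
      M⁺ i j  ≡⟨ setEdge-otherCol M₁ a b₀ true i j j≢b₀ ⟩
      M₁ i j  ≡⟨ eq ⟩
      M i j   ∎))
      where open ≡-Reasoning

    lift : ∀ i → Unmatching (ZB R) i → Unmatching ZB′ i
    lift i U = record { Unmatching U hiding (agrees) ; agrees = λ i′ j ne → insert-⊇ (ZB R) b₀ j (Unmatching.agrees U i′ j ne) }

    R′ : Reached
    R′ = record
      { ZA = ZA′ ; ZB = ZB′
      ; unmatched∈ZA = λ i free → insert-⊇ (ZA R) a₂ i (unmatched∈ZA R i free)
      ; partner∈ZA = partner∈ZA′ ; ZB-matched = ZB′-matched ; unmatching = unmatching′ }
      where
      partner∈ZA′ : ∀ i j → ZB′ j ≡ true → M i j ≡ true → ZA′ i ≡ true
      partner∈ZA′ i j j∈ Mij with insert-cases (ZB R) b₀ j j∈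
      ... | inj₁ j∈ZB = insert-⊇ (ZA R) a₂ i (partner∈ZA R i j j∈ZB Mij)
      ... | inj₂ refl with M-col-unique i a₂ j Mij Ma₂b₀
      ...   | refl = insert-here (ZA R) i
      ZB′-matched : ∀ j → ZB′ j ≡ true → Σ (Fin n) λ i → M i j ≡ true
      ZB′-matched j j∈ with insert-cases (ZB R) b₀ j j∈
      ... | inj₁ j∈ZB = ZB-matched R j j∈ZB
      ... | inj₂ refl = a₂ , Ma₂b₀
      unmatching′ : ∀ i → ZA′ i ≡ true → Unmatching ZB′ i
      unmatching′ i i∈ with insert-cases (ZA R) a₂ i i∈
      ... | inj₁ i∈ZA = lift i (unmatching R i i∈ZA)
      ... | inj₂ refl = record { matching = M′ ; isMatching = M′-matching ; same-size = size-M′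
                               ; agrees = M′-agrees ; leaves-free = a₂-free }

    count-ZB′ : count (ZB R′) ≡ suc (count (ZB R))
    count-ZB′ = count-insert (ZB R) b₀ b₀∉

  saturate : ∀ fuel (R : Reached) → fuel + count (ZB R) ≡ m → TightCover H M
  saturate fuel R fuel+ZB≡m with FP.any? (λ i → FP.any? (λ j →
                                   ((ZA R i ≟ true) ×-dec (H i j ≟ true)) ×-dec (ZB R j ≟ false)))
  ... | no closed = closed⇒tightCover R (λ i j i∈ Hij → BP.¬-not (λ j∉ → closed (i , j , (i∈ , Hij) , j∉)))
  saturate zero R ZB≡m | yes (i , j , _ , j∉) = ⊥-elim (NP.<-irrefl ZB≡m (count<n (ZB R) j j∉))
  saturate (suc fuel) R fuel+ZB≡m | yes (i , j , (i∈ , Hij) , j∉) =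
    saturate fuel (Grow.R′ R i j i∈ Hij j∉)
      (trans (cong (fuel +_) (Grow.count-ZB′ R i j i∈ Hij j∉)) (trans (NP.+-suc fuel _) fuel+ZB≡m))

  initial : Reached
  initial = record
    { ZA = λ i → does (FP.all? λ j → M i j ≟ false) ; ZB = const false
    ; unmatched∈ZA = unmatched∈ZA₀ ; partner∈ZA = λ _ _ () ; ZB-matched = λ _ () ; unmatching = unmatching₀ }
    where
    unmatched∈ZA₀ : ∀ i → (∀ j → M i j ≡ false) → does (FP.all? λ j → M i j ≟ false) ≡ true
    unmatched∈ZA₀ i = dec-true (FP.all? λ j → M i j ≟ false)
    unmatching₀ : ∀ i → does (FP.all? λ j → M i j ≟ false) ≡ true → Unmatching (const false) i
    unmatching₀ i = from-free (FP.all? λ j → M i j ≟ false)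
      where
      from-free : (free? : Dec (∀ j → M i j ≡ false)) → does free? ≡ true → Unmatching (const false) i
      from-free (yes free) _ = record { matching = M ; isMatching = isM ; same-size = refl
                                      ; agrees = λ _ _ M≢M → ⊥-elim (M≢M refl) ; leaves-free = free }
      from-free (no _) ()

  tightCover : TightCover H M
  tightCover = saturate m initial (trans (cong (m +_) (count-false {m})) (NP.+-identityʳ m))

-- Degree-preserving exchanges of two rows

SameDegrees : ∀ {n m} → BipGraph n m → BipGraph n m → Set
SameDegrees G G′ = (∀ i → degA G′ i ≡ degA G i) × (∀ j → degB G′ j ≡ degB G j)

realizes-sameDegrees : ∀ {n m} {a : Vec ℕ n} {b : Vec ℕ m} {G G′ : BipGraph n m} →
  SameDegrees G G′ → Realizes G a b → Realizes G′ a b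
realizes-sameDegrees (sameA , sameB) (realA , realB) =
  (λ i → trans (sameA i) (realA i)) , (λ j → trans (sameB j) (realB j))

replaceRows : ∀ {n m} → BipGraph n m → Fin n → Fin n → (Fin m → Bool) → (Fin m → Bool) → BipGraph n m
replaceRows G p q f g = updateAt (updateAt G q (const g)) p (const f)

module ReplaceRows {n m} (G : BipGraph n m) (p q : Fin n) (p≢q : p ≢ q) (f g : Fin m → Bool) where
  G′ : BipGraph n m
  G′ = replaceRows G p q f g

  row-p : G′ p ≡ f
  row-p = updateAt-updates p _

  row-q : G′ q ≡ g
  row-q = trans (updateAt-minimal q p _ (p≢q ∘ sym)) (updateAt-updates q G)

  row-other : ∀ i → i ≢ p → i ≢ q → G′ i ≡ G i
  row-other i i≢p i≢q = trans (updateAt-minimal i p _ i≢p) (updateAt-minimal i q G i≢q)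

  sameDegrees : (∀ j → bit (f j) + bit (g j) ≡ bit (G p j) + bit (G q j)) → count f ≡ count (G p) →
    SameDegrees G G′
  sameDegrees columnwise deg-f = rows , cols
    where
    deg-p : degA G′ p ≡ degA G p
    deg-p = trans (cong count row-p) deg-f
    deg-q : degA G′ q ≡ degA G q
    deg-q = NP.+-cancelˡ-≡ (count f) _ _ (begin
      count f + count (G′ q)      ≡⟨ cong (λ r → count f + count r) row-q ⟩
      count f + count g           ≡⟨ count-+-pointwise f g (G p) (G q) columnwise ⟩
      count (G p) + count (G q)   ≡⟨ cong (_+ count (G q)) deg-f ⟨
      count f + count (G q)       ∎)
      where open ≡-Reasoning
    rows : ∀ i → degA G′ i ≡ degA G i
    rows i with i FP.≟ p | i FP.≟ q
    ... | yes refl | _        = deg-p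
    ... | no _     | yes refl = deg-q
    ... | no i≢p   | no i≢q   = cong count (row-other i i≢p i≢q)
    cols : ∀ j → degB G′ j ≡ degB G j
    cols j = sym (count-differ-at₂ (λ i → G i j) (λ i → G′ i j) p q p≢q
      (λ i i≢p i≢q → sym (cong-app (row-other i i≢p i≢q) j))
      (trans (sym (columnwise j)) (sym (cong₂ (λ x y → bit x + bit y) (cong-app row-p j) (cong-app row-q j)))))

flipAt : ∀ {m} → Fin m → Fin m → (Fin m → Bool) → Fin m → Bool
flipAt c d h = updateAt (updateAt h d not) c not

module _ {m} (c d : Fin m) (c≢d : c ≢ d) (h : Fin m → Bool) where
  flipAt-c : flipAt c d h c ≡ not (h c)
  flipAt-c = trans (updateAt-updates c _) (cong not (updateAt-minimal c d h c≢d))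

  flipAt-d : flipAt c d h d ≡ not (h d)
  flipAt-d = trans (updateAt-minimal d c _ (c≢d ∘ sym)) (updateAt-updates d h)

  flipAt-other : ∀ j → j ≢ c → j ≢ d → flipAt c d h j ≡ h j
  flipAt-other j j≢c j≢d = trans (updateAt-minimal j c _ j≢c) (updateAt-minimal j d h j≢d)

  flipAt-true : ∀ j → flipAt c d h j ≡ true → h j ≡ true ⊎ (j ≡ c ⊎ j ≡ d)
  flipAt-true j e with j FP.≟ c | j FP.≟ d
  ... | yes j≡c | _       = inj₂ (inj₁ j≡c)
  ... | no _    | yes j≡d = inj₂ (inj₂ j≡d)
  ... | no j≢c  | no j≢d  = inj₁ (trans (sym (flipAt-other j j≢c j≢d)) e)

module TwoSwitch {n m} (G : BipGraph n m) (p q : Fin n) (c d : Fin m) (p≢q : p ≢ q) (c≢d : c ≢ d)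
   (pc : G p c ≡ true) (pd : G p d ≡ false) (qc : G q c ≡ false) (qd : G q d ≡ true) where
  open ReplaceRows G p q p≢q (flipAt c d (G p)) (flipAt c d (G q)) public using (G′)
  open ReplaceRows G p q p≢q (flipAt c d (G p)) (flipAt c d (G q)) hiding (G′)

  sameDegrees′ : SameDegrees G G′
  sameDegrees′ = sameDegrees columnwise deg-p
    where
    flipped-pair : ∀ x y → y ≡ not x → bit (not x) + bit (not y) ≡ bit x + bit y
    flipped-pair true  .false refl = refl
    flipped-pair false .true  refl = refl
    columnwise : ∀ j → bit (flipAt c d (G p) j) + bit (flipAt c d (G q) j) ≡ bit (G p j) + bit (G q j)
    columnwise j with j FP.≟ c | j FP.≟ d
    ... | yes refl | _ = subst₂ (λ x y → bit x + bit y ≡ bit (G p j) + bit (G q j))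
                           (sym (flipAt-c c d c≢d (G p))) (sym (flipAt-c c d c≢d (G q)))
                           (flipped-pair (G p j) (G q j) (trans qc (sym (cong not pc))))
    ... | no _ | yes refl = subst₂ (λ x y → bit x + bit y ≡ bit (G p j) + bit (G q j))
                           (sym (flipAt-d c d c≢d (G p))) (sym (flipAt-d c d c≢d (G q)))
                           (flipped-pair (G p j) (G q j) (trans qd (sym (cong not pd))))
    ... | no j≢c | no j≢d = cong₂ (λ x y → bit x + bit y)
                           (flipAt-other c d c≢d (G p) j j≢c j≢d) (flipAt-other c d c≢d (G q) j j≢c j≢d)
    deg-p : count (flipAt c d (G p)) ≡ count (G p)
    deg-p = sym (count-differ-at₂ (G p) (flipAt c d (G p)) c d c≢d
      (λ j j≢c j≢d → sym (flipAt-other c d c≢d (G p) j j≢c j≢d))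
      (subst₂ (λ x y → bit (G p c) + bit (G p d) ≡ bit x + bit y)
        (sym (trans (flipAt-c c d c≢d (G p)) (cong not pc))) (sym (trans (flipAt-d c d c≢d (G p)) (cong not pd)))
        (cong₂ (λ x y → bit x + bit y) pc pd)))

  switched-pd : G′ p d ≡ true
  switched-pd = trans (cong-app row-p d) (trans (flipAt-d c d c≢d (G p)) (cong not pd))

  switched-qc : G′ q c ≡ true
  switched-qc = trans (cong-app row-q c) (trans (flipAt-c c d c≢d (G q)) (cong not qc))

  kept : ∀ i j → G i j ≡ true → ¬ (i ≡ p × j ≡ c) → ¬ (i ≡ q × j ≡ d) → G′ i j ≡ true
  kept i j Gij not-pc not-qd with i FP.≟ p | i FP.≟ q
  ... | yes refl | _ = trans (cong-app row-p j) (trans (flipAt-other c d c≢d (G p) j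
        (λ j≡c → not-pc (refl , j≡c)) (λ { refl → true≢false (trans (sym Gij) pd) })) Gij)
  ... | no _ | yes refl = trans (cong-app row-q j) (trans (flipAt-other c d c≢d (G q) j
        (λ { refl → true≢false (trans (sym Gij) qc) }) (λ j≡d → not-qd (refl , j≡d))) Gij)
  ... | no i≢p | no i≢q = trans (cong-app (row-other i i≢p i≢q) j) Gij

  edge-cases : ∀ i j → G′ i j ≡ true → G i j ≡ true ⊎ ((i ≡ p × j ≡ d) ⊎ (i ≡ q × j ≡ c))
  edge-cases i j e with i FP.≟ p | i FP.≟ q
  ... | yes refl | _ with flipAt-true c d c≢d (G p) j (trans (sym (cong-app row-p j)) e)
  ...   | inj₁ Gpj = inj₁ Gpj
  ...   | inj₂ (inj₁ refl) = ⊥-elim (true≢false (trans (sym e) (trans (cong-app row-p c)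
                               (trans (flipAt-c c d c≢d (G p)) (cong not pc)))))
  ...   | inj₂ (inj₂ j≡d) = inj₂ (inj₁ (refl , j≡d))
  edge-cases i j e | no _ | yes refl with flipAt-true c d c≢d (G q) j (trans (sym (cong-app row-q j)) e)
  ...   | inj₁ Gqj = inj₁ Gqj
  ...   | inj₂ (inj₁ j≡c) = inj₂ (inj₂ (refl , j≡c))
  ...   | inj₂ (inj₂ refl) = ⊥-elim (true≢false (trans (sym e) (trans (cong-app row-q d)
                               (trans (flipAt-d c d c≢d (G q)) (cong not qd)))))
  edge-cases i j e | no i≢p | no i≢q = inj₁ (trans (sym (cong-app (row-other i i≢p i≢q) j)) e)

onlyIn : ∀ {n m} → BipGraph n m → Fin n → Fin n → Fin m → Bool
onlyIn G x u j = G x j ∧ not (G u j)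

onlyIn-elim : ∀ {n m} (G : BipGraph n m) x u j → onlyIn G x u j ≡ true → G x j ≡ true × G u j ≡ false
onlyIn-elim G x u j e with G x j | G u j
... | true  | false = refl , refl
... | true  | true  = ⊥-elim (true≢false (sym e))
... | false | _     = ⊥-elim (true≢false (sym e))

-- With |T| = |N(u) ∖ N(x)| all degrees survive, the new N(u) lies inside the old N(x), and the
-- new N(x) contains the old N(u).
module Rebalance {n m} (G : BipGraph n m) (x u : Fin n) (x≢u : x ≢ u) (T : Fin m → Bool)
   (T⊆ : ∀ j → T j ≡ true → onlyIn G x u j ≡ true) (count-T : count T ≡ count (onlyIn G u x)) where
  newU : Fin m → Bool
  newU j = (G x j ∧ G u j) ∨ T j

  newX : Fin m → Bool
  newX j = (G x j ∨ G u j) ∧ not (T j)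

  open ReplaceRows G u x (x≢u ∘ sym) newU newX public using (G′)
  open ReplaceRows G u x (x≢u ∘ sym) newU newX hiding (G′)

  other : ∀ i j → i ≢ x → i ≢ u → G′ i j ≡ G i j
  other i j i≢x i≢u = cong-app (row-other i i≢u i≢x) j

  sameDegrees′ : SameDegrees G G′
  sameDegrees′ = sameDegrees columnwise deg-u
    where
    columnwise : ∀ j → bit (newU j) + bit (newX j) ≡ bit (G u j) + bit (G x j)
    columnwise j with T j in Tj
    ... | true  with onlyIn-elim G x u j (T⊆ j Tj)
    ...   | Gxj , Guj rewrite Gxj | Guj = refl
    columnwise j | false with G x j | G u j
    ... | true  | true  = refl
    ... | true  | false = refl
    ... | false | true  = refl
    ... | false | false = refl
    newU∧u : ∀ j → (newU j ∧ G u j) ≡ (G u j ∧ G x j)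
    newU∧u j with T j in Tj
    ... | true with onlyIn-elim G x u j (T⊆ j Tj)
    ...   | Gxj , Guj rewrite Gxj | Guj = refl
    newU∧u j | false rewrite BP.∨-identityʳ (G x j ∧ G u j) with G x j | G u j
    ... | true  | true  = refl
    ... | true  | false = refl
    ... | false | true  = refl
    ... | false | false = refl
    newU∧¬u : ∀ j → (newU j ∧ not (G u j)) ≡ T j
    newU∧¬u j with T j in Tj
    ... | true with onlyIn-elim G x u j (T⊆ j Tj)
    ...   | Gxj , Guj rewrite Gxj | Guj = refl
    newU∧¬u j | false rewrite BP.∨-identityʳ (G x j ∧ G u j) with G x j | G u j
    ... | true  | true  = refl
    ... | true  | false = refl
    ... | false | _     = refl
    deg-u : count newU ≡ count (G u)
    deg-u = begin
      count newU                                                  ≡⟨ count-split newU (G u) ⟩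
      count (λ j → newU j ∧ G u j) + count (λ j → newU j ∧ not (G u j))
        ≡⟨ cong₂ _+_ (count-cong newU∧u) (count-cong newU∧¬u) ⟩
      count (λ j → G u j ∧ G x j) + count T                       ≡⟨ cong (count (λ j → G u j ∧ G x j) +_) count-T ⟩
      count (λ j → G u j ∧ G x j) + count (onlyIn G u x)          ≡⟨ count-split (G u) (G x) ⟨
      count (G u)                                                 ∎
      where open ≡-Reasoning

  u⊆newX : ∀ j → G u j ≡ true → G′ x j ≡ true
  u⊆newX j Guj = trans (cong-app row-q j) newXj
    where
    newXj : newX j ≡ true
    newXj with T j in Tj
    ... | true  = ⊥-elim (true≢false (trans (sym Guj) (proj₂ (onlyIn-elim G x u j (T⊆ j Tj)))))
    ... | false rewrite Guj | BP.∨-zeroʳ (G x j) = refl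

  newU⊆x : ∀ j → G′ u j ≡ true → G x j ≡ true
  newU⊆x j e = newU-⊆ (trans (sym (cong-app row-p j)) e)
    where
    newU-⊆ : newU j ≡ true → G x j ≡ true
    newU-⊆ e with T j in Tj
    ... | true = proj₁ (onlyIn-elim G x u j (T⊆ j Tj))
    ... | false with G x j
    ...   | true  = refl
    ...   | false = e

  newX⊆x∪u : ∀ j → G′ x j ≡ true → G x j ≡ true ⊎ G u j ≡ true
  newX⊆x∪u j e = newX-⊆ (trans (sym (cong-app row-q j)) e)
    where
    newX-⊆ : newX j ≡ true → G x j ≡ true ⊎ G u j ≡ true
    newX-⊆ e with G x j | G u j
    ... | true  | _     = inj₁ refl
    ... | false | true  = inj₂ refl
    ... | false | false = ⊥-elim (true≢false (sym e))

  newU-keeps : ∀ z → G x z ≡ true → G u z ≡ true ⊎ T z ≡ true → G′ u z ≡ true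
  newU-keeps z Gxz Guz∨Tz = trans (cong-app row-p z) (newUz Guz∨Tz)
    where
    newUz : G u z ≡ true ⊎ T z ≡ true → newU z ≡ true
    newUz (inj₁ Guz) rewrite Gxz | Guz = refl
    newUz (inj₂ Tz) rewrite Tz = BP.∨-zeroʳ _

onlyIn-intro : ∀ {n m} (G : BipGraph n m) x u j → G x j ≡ true → G u j ≡ false → onlyIn G x u j ≡ true
onlyIn-intro G x u j Gxj Guj rewrite Gxj | Guj = refl

module RebalancingSet {n m} (G : BipGraph n m) (x u : Fin n) (u≤x : degA G u ≤ degA G x) where
  count-onlyIn≤ : count (onlyIn G u x) ≤ count (onlyIn G x u)
  count-onlyIn≤ = NP.+-cancelˡ-≤ (count (λ j → G x j ∧ G u j)) _ _ (begin
    count (λ j → G x j ∧ G u j) + count (onlyIn G u x)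
      ≡⟨ cong (_+ count (onlyIn G u x)) (count-cong λ j → BP.∧-comm (G x j) (G u j)) ⟩
    count (λ j → G u j ∧ G x j) + count (onlyIn G u x) ≡⟨ count-split (G u) (G x) ⟨
    count (G u)                                        ≤⟨ u≤x ⟩
    count (G x)                                        ≡⟨ count-split (G x) (G u) ⟩
    count (λ j → G x j ∧ G u j) + count (onlyIn G x u) ∎)
    where open NP.≤-Reasoning

  RebalancingSet : Set
  RebalancingSet = Σ (Fin m → Bool) λ T → (∀ j → T j ≡ true → onlyIn G x u j ≡ true) × count T ≡ count (onlyIn G u x)

  rebalancingSet : RebalancingSet
  rebalancingSet = subset-of-count (onlyIn G x u) _ count-onlyIn≤

  rebalancingSet-through : ∀ z y → onlyIn G x u z ≡ true → onlyIn G u x y ≡ true →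
    Σ RebalancingSet λ (T , _) → T z ≡ true
  rebalancingSet-through z y z∈ y∈
    with subset-of-count (remove (onlyIn G x u) z) (count (remove (onlyIn G u x) y))
           (s≤s⁻¹ (subst₂ _≤_ (count-remove _ y y∈) (count-remove _ z z∈) count-onlyIn≤))
  ... | Q , Q⊆ , count-Q = (insert Q z , T⊆ , count-T) , insert-here Q z
    where
    Qz : Q z ≡ false
    Qz = BP.¬-not (λ Qz → true≢false (trans (sym (Q⊆ z Qz)) (remove-here (onlyIn G x u) z)))
    T⊆ : ∀ j → insert Q z j ≡ true → onlyIn G x u j ≡ true
    T⊆ j e with insert-cases Q z j e
    ... | inj₁ Qj   = remove-⊆ (onlyIn G x u) z j (Q⊆ j Qj)
    ... | inj₂ refl = z∈
    count-T : count (insert Q z) ≡ count (onlyIn G u x)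
    count-T = trans (count-insert Q z Qz) (trans (cong suc count-Q) (sym (count-remove _ y y∈)))

-- Covered matchings and the moves between them

eitherOrNeither : ∀ {k} (s t r : Fin k) → r ≡ s ⊎ (r ≡ t ⊎ (r ≢ s × r ≢ t))
eitherOrNeither s t r with r FP.≟ s | r FP.≟ t
... | yes r≡s | _       = inj₁ r≡s
... | no _    | yes r≡t = inj₂ (inj₁ r≡t)
... | no r≢s  | no r≢t  = inj₂ (inj₂ (r≢s , r≢t))

module _ {ν} (s t : Fin ν) where
  transpose-here : transpose s t s ≡ t
  transpose-here with s FP.≟ s
  ... | yes _   = refl
  ... | no s≢s  = ⊥-elim (s≢s refl)

  transpose-there : transpose s t t ≡ s
  transpose-there with t FP.≟ s
  ... | yes t≡s = t≡s
  ... | no _ with t FP.≟ t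
  ...   | yes _  = refl
  ...   | no t≢t = ⊥-elim (t≢t refl)

  transpose-other : ∀ r → r ≢ s → r ≢ t → transpose s t r ≡ r
  transpose-other r r≢s r≢t with r FP.≟ s
  ... | yes r≡s = ⊥-elim (r≢s r≡s)
  ... | no _ with r FP.≟ t
  ...   | yes r≡t = ⊥-elim (r≢t r≡t)
  ...   | no _    = refl

  transpose-injective : ∀ {r r′} → transpose s t r ≡ transpose s t r′ → r ≡ r′
  transpose-injective eq = trans (sym (transpose-inverse t s)) (trans (cong (transpose t s) eq) (transpose-inverse t s))

  transpose-preserves : ∀ {A : Set} (f : Fin ν → A) → f s ≡ f t → ∀ r → f (transpose s t r) ≡ f r
  transpose-preserves f fs≡ft r with eitherOrNeither s t r
  ... | inj₁ refl               = trans (cong f transpose-here) (sym fs≡ft)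
  ... | inj₂ (inj₁ refl)        = trans (cong f transpose-there) fs≡ft
  ... | inj₂ (inj₂ (r≢s , r≢t)) = cong f (transpose-other r r≢s r≢t)

-- A realization together with ν matching edges row t – col t whose chosen ends cover all edges:
-- the A-end when inA t, the B-end otherwise.
record CoveredMatching {n m} (a : Vec ℕ n) (b : Vec ℕ m) (ν : ℕ) (inA : Fin ν → Bool) : Set where
  field
    G : BipGraph n m
    row : Fin ν → Fin n
    col : Fin ν → Fin m
    realizes : Realizes G a b
    row-inj : ∀ {s t} → row s ≡ row t → s ≡ t
    col-inj : ∀ {s t} → col s ≡ col t → s ≡ t
    matched : ∀ t → G (row t) (col t) ≡ true
    covered : ∀ i j → G i j ≡ true →
      (Σ (Fin ν) λ t → inA t ≡ true × row t ≡ i) ⊎ (Σ (Fin ν) λ t → inA t ≡ false × col t ≡ j)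

open CoveredMatching

transposeCM : ∀ {n m} {a : Vec ℕ n} {b : Vec ℕ m} {ν} {inA inB : Fin ν → Bool} → (∀ t → inB t ≡ not (inA t)) →
  CoveredMatching a b ν inA → CoveredMatching b a ν inB
transposeCM {inA = inA} {inB} inB≡ S = record
  { G = λ j i → G S i j ; row = col S ; col = row S ; realizes = proj₂ (realizes S) , proj₁ (realizes S)
  ; row-inj = col-inj S ; col-inj = row-inj S ; matched = matched S ; covered = covered′ }
  where
  covered′ : ∀ j i → G S i j ≡ true →
    (Σ _ λ t → inB t ≡ true × col S t ≡ j) ⊎ (Σ _ λ t → inB t ≡ false × row S t ≡ i)
  covered′ j i e with covered S i j e
  ... | inj₁ (t , inAt , eq) = inj₂ (t , trans (inB≡ t) (cong not inAt) , eq)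
  ... | inj₂ (t , inAt , eq) = inj₁ (t , trans (inB≡ t) (cong not inAt) , eq)

relabel : ∀ {n m} {a : Vec ℕ n} {b : Vec ℕ m} {ν} {inA : Fin ν → Bool} →
  (S : CoveredMatching a b ν inA) (s t : Fin ν) → inA s ≡ inA t →
  Σ (CoveredMatching a b ν inA) λ S′ →
    (∀ r → row S′ r ≡ row S (transpose s t r)) × (∀ r → col S′ r ≡ col S (transpose s t r))
relabel {ν = ν} {inA} S s t same-side = S′ , (λ _ → refl) , (λ _ → refl)
  where
  covered′ : ∀ i j → G S i j ≡ true →
    (Σ (Fin ν) λ r → inA r ≡ true × row S (transpose s t r) ≡ i) ⊎
    (Σ (Fin ν) λ r → inA r ≡ false × col S (transpose s t r) ≡ j)
  covered′ i j e with covered S i j e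
  ... | inj₁ (r , inAr , eq) = inj₁ (transpose t s r , trans (transpose-preserves t s inA (sym same-side) r) inAr ,
                                      trans (cong (row S) (transpose-inverse s t)) eq)
  ... | inj₂ (r , inAr , eq) = inj₂ (transpose t s r , trans (transpose-preserves t s inA (sym same-side) r) inAr ,
                                      trans (cong (col S) (transpose-inverse s t)) eq)
  S′ : CoveredMatching _ _ ν inA
  S′ = record
    { G = G S ; row = row S ∘ transpose s t ; col = col S ∘ transpose s t ; realizes = realizes S
    ; row-inj = transpose-injective s t ∘ row-inj S ; col-inj = transpose-injective s t ∘ col-inj S
    ; matched = matched S ∘ transpose s t ; covered = covered′ }

degA-antitone : ∀ {n m} {a : Vec ℕ n} {b : Vec ℕ m} {G : BipGraph n m} → Realizes G a b → Nonincreasing a →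
  ∀ x u → toℕ x ≤ toℕ u → degA G u ≤ degA G x
degA-antitone (realA , _) a↓ x u x≤u = subst₂ _≤_ (sym (realA u)) (sym (realA x)) (a↓ x u x≤u)

<⇒≢ : ∀ {k} {x u : Fin k} → toℕ x < toℕ u → x ≢ u
<⇒≢ x<u refl = NP.<-irrefl refl x<u

module MoveRow {n m} {a : Vec ℕ n} {b : Vec ℕ m} {ν : ℕ} {inA : Fin ν → Bool} (a↓ : Nonincreasing a)
  (S : CoveredMatching a b ν inA) (t : Fin ν) (x : Fin n) (x-free : ∀ s → row S s ≢ x)
  (x<u : toℕ x < toℕ (row S t)) where
  u : Fin n
  u = row S t

  transfer : RebalancingSet.RebalancingSet (G S) x u (degA-antitone {a = a} {b = b} (realizes S) a↓ x u (NP.<⇒≤ x<u))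
  transfer = RebalancingSet.rebalancingSet (G S) x u (degA-antitone {a = a} {b = b} (realizes S) a↓ x u (NP.<⇒≤ x<u))
  open Rebalance (G S) x u (<⇒≢ x<u) (proj₁ transfer) (proj₁ (proj₂ transfer)) (proj₂ (proj₂ transfer))

  row′ : Fin ν → Fin n
  row′ = updateAt (row S) t (const x)

  row′-inj : ∀ {r r′} → row′ r ≡ row′ r′ → r ≡ r′
  row′-inj {r} {r′} eq with r FP.≟ t | r′ FP.≟ t
  ... | yes refl | yes refl = refl
  ... | yes refl | no r′≢t  = ⊥-elim (x-free r′ (trans (sym (updateAt-minimal r′ t (row S) r′≢t))
                                  (trans (sym eq) (updateAt-updates t (row S)))))
  ... | no r≢t   | yes refl = ⊥-elim (x-free r (trans (sym (updateAt-minimal r t (row S) r≢t))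
                                  (trans eq (updateAt-updates t (row S)))))
  ... | no r≢t   | no r′≢t  = row-inj S (trans (sym (updateAt-minimal r t (row S) r≢t))
                                  (trans eq (updateAt-minimal r′ t (row S) r′≢t)))

  covered-by-col : ∀ j → G S x j ≡ true → Σ (Fin ν) λ s → inA s ≡ false × col S s ≡ j
  covered-by-col j e with covered S x j e
  ... | inj₁ (s , _ , eq) = ⊥-elim (x-free s eq)
  ... | inj₂ by-col       = by-col

  matched′ : ∀ r → G′ (row′ r) (col S r) ≡ true
  matched′ r with r FP.≟ t
  ... | yes refl = subst (λ i → G′ i (col S t) ≡ true) (sym (updateAt-updates t (row S)))
                     (u⊆newX (col S t) (matched S t))
  ... | no r≢t   = subst (λ i → G′ i (col S r) ≡ true) (sym (updateAt-minimal r t (row S) r≢t))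
                     (trans (other (row S r) (col S r) (x-free r) (r≢t ∘ row-inj S)) (matched S r))

  Covers′ : Fin n → Fin m → Set
  Covers′ i j = (Σ (Fin ν) λ s → inA s ≡ true × row′ s ≡ i) ⊎ (Σ (Fin ν) λ s → inA s ≡ false × col S s ≡ j)

  covered′ : ∀ i j → G′ i j ≡ true → Covers′ i j
  covered′ i j e with i FP.≟ x | i FP.≟ u
  ... | yes refl | _ with newX⊆x∪u j e
  ...   | inj₁ Gxj = inj₂ (covered-by-col j Gxj)
  ...   | inj₂ Guj with covered S u j Guj
  ...     | inj₂ by-col = inj₂ by-col
  ...     | inj₁ (s , inAs , eq) with row-inj S eq
  ...       | refl = inj₁ (s , inAs , updateAt-updates s (row S))
  covered′ i j e | no _ | yes refl = inj₂ (covered-by-col j (newU⊆x j e))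
  covered′ i j e | no i≢x | no i≢u with covered S i j (trans (sym (other i j i≢x i≢u)) e)
  ... | inj₂ by-col = inj₂ by-col
  ... | inj₁ (s , inAs , eq) =
    inj₁ (s , inAs , trans (updateAt-minimal s t (row S) (λ { refl → i≢u (sym eq) })) eq)

  result : CoveredMatching a b ν inA
  result = record
    { G = G′ ; row = row′ ; col = col S ; realizes = realizes-sameDegrees {a = a} {b = b} sameDegrees′ (realizes S)
    ; row-inj = row′-inj ; col-inj = col-inj S ; matched = matched′ ; covered = covered′ }

moveRow : ∀ {n m} {a : Vec ℕ n} {b : Vec ℕ m} {ν} {inA : Fin ν → Bool} → Nonincreasing a →
  (S : CoveredMatching a b ν inA) (t : Fin ν) (x : Fin n) → (∀ s → row S s ≢ x) → toℕ x < toℕ (row S t) →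
  Σ (CoveredMatching a b ν inA) λ S′ →
    row S′ t ≡ x × (∀ s → s ≢ t → row S′ s ≡ row S s) × (∀ s → col S′ s ≡ col S s)
moveRow a↓ S t x x-free x<u = MoveRow.result a↓ S t x x-free x<u ,
  updateAt-updates t (row S) , (λ s s≢t → updateAt-minimal s t (row S) s≢t) , (λ _ → refl)

module SwapRowsAcross {n m} {a : Vec ℕ n} {b : Vec ℕ m} {ν : ℕ} {inA : Fin ν → Bool} (a↓ : Nonincreasing a)
  (S : CoveredMatching a b ν inA) (s t : Fin ν) (inA-s : inA s ≡ true) (inA-t : inA t ≡ false)
  (x<u : toℕ (row S t) < toℕ (row S s)) where
  x u : Fin n
  x = row S t
  u = row S s

  y z : Fin m
  y = col S s
  z = col S t

  u≤x : degA (G S) u ≤ degA (G S) x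
  u≤x = degA-antitone {a = a} {b = b} (realizes S) a↓ x u (NP.<⇒≤ x<u)

  covered-by-col : ∀ j → G S x j ≡ true → Σ (Fin ν) λ r → inA r ≡ false × col S r ≡ j
  covered-by-col j e with covered S x j e
  ... | inj₂ by-col = by-col
  ... | inj₁ (r , inAr , eq) with row-inj S eq
  ...   | refl = ⊥-elim (true≢false (trans (sym inAr) inA-t))

  xy-absent : G S x y ≡ false
  xy-absent = BP.¬-not λ e → let (r , inAr , eq) = covered-by-col y e in
    true≢false (trans (sym inA-s) (trans (cong inA (sym (col-inj S eq))) inAr))

  transfer : Σ (Fin m → Bool) λ T → (∀ j → T j ≡ true → onlyIn (G S) x u j ≡ true) ×
        count T ≡ count (onlyIn (G S) u x) × (G S u z ≡ true ⊎ T z ≡ true)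
  transfer with G S u z in uz
  ... | true  = let (T , T⊆ , count-T) = RebalancingSet.rebalancingSet (G S) x u u≤x in T , T⊆ , count-T , inj₁ refl
  ... | false = let ((T , T⊆ , count-T) , Tz) = RebalancingSet.rebalancingSet-through (G S) x u u≤x z y
                      (onlyIn-intro (G S) x u z (matched S t) uz) (onlyIn-intro (G S) u x y (matched S s) xy-absent)
                in T , T⊆ , count-T , inj₂ Tz

  open Rebalance (G S) x u (<⇒≢ x<u) (proj₁ transfer) (proj₁ (proj₂ transfer)) (proj₁ (proj₂ (proj₂ transfer)))

  s≢t : s ≢ t
  s≢t s≡t = <⇒≢ x<u (cong (row S) (sym s≡t))

  row′ : Fin ν → Fin n
  row′ = row S ∘ transpose s t

  matched′ : ∀ r → G′ (row′ r) (col S r) ≡ true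
  matched′ r with eitherOrNeither s t r
  ... | inj₁ refl               = subst (λ i → G′ i y ≡ true) (sym (cong (row S) (transpose-here s t)))
                                (u⊆newX y (matched S s))
  ... | inj₂ (inj₁ refl)        = subst (λ i → G′ i z ≡ true) (sym (cong (row S) (transpose-there s t)))
                                (newU-keeps z (matched S t) (proj₂ (proj₂ (proj₂ transfer))))
  ... | inj₂ (inj₂ (r≢s , r≢t)) = subst (λ i → G′ i (col S r) ≡ true)
                                    (sym (cong (row S) (transpose-other s t r r≢s r≢t)))
                                (trans (other (row S r) (col S r) (r≢t ∘ row-inj S) (r≢s ∘ row-inj S)) (matched S r))

  covered′ : ∀ i j → G′ i j ≡ true →
    (Σ (Fin ν) λ r → inA r ≡ true × row′ r ≡ i) ⊎ (Σ (Fin ν) λ r → inA r ≡ false × col S r ≡ j)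
  covered′ i j e with i FP.≟ x | i FP.≟ u
  ... | yes refl | _ with newX⊆x∪u j e
  ...   | inj₁ Gxj = inj₂ (covered-by-col j Gxj)
  ...   | inj₂ Guj with covered S u j Guj
  ...     | inj₂ by-col = inj₂ by-col
  ...     | inj₁ _      = inj₁ (s , inA-s , cong (row S) (transpose-here s t))
  covered′ i j e | no _ | yes refl = inj₂ (covered-by-col j (newU⊆x j e))
  covered′ i j e | no i≢x | no i≢u with covered S i j (trans (sym (other i j i≢x i≢u)) e)
  ... | inj₂ by-col = inj₂ by-col
  ... | inj₁ (r , inAr , eq) = inj₁ (r , inAr , trans (cong (row S) (transpose-other s t r
          (λ { refl → i≢u (sym eq) }) (λ { refl → i≢x (sym eq) }))) eq)

  result : CoveredMatching a b ν inA
  result = record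
    { G = G′ ; row = row′ ; col = col S ; realizes = realizes-sameDegrees {a = a} {b = b} sameDegrees′ (realizes S)
    ; row-inj = transpose-injective s t ∘ row-inj S ; col-inj = col-inj S ; matched = matched′ ; covered = covered′ }

swapRowsAcross : ∀ {n m} {a : Vec ℕ n} {b : Vec ℕ m} {ν} {inA : Fin ν → Bool} → Nonincreasing a →
  (S : CoveredMatching a b ν inA) (s t : Fin ν) → inA s ≡ true → inA t ≡ false → toℕ (row S t) < toℕ (row S s) →
  Σ (CoveredMatching a b ν inA) λ S′ → row S′ s ≡ row S t × row S′ t ≡ row S s ×
    (∀ r → r ≢ s → r ≢ t → row S′ r ≡ row S r) × (∀ r → col S′ r ≡ col S r)
swapRowsAcross a↓ S s t inA-s inA-t x<u = SwapRowsAcross.result a↓ S s t inA-s inA-t x<u ,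
  cong (row S) (transpose-here s t) , cong (row S) (transpose-there s t) ,
  (λ r r≢s r≢t → cong (row S) (transpose-other s t r r≢s r≢t)) , (λ _ → refl)

degB-antitone : ∀ {n m} {a : Vec ℕ n} {b : Vec ℕ m} {G : BipGraph n m} → Realizes G a b → Nonincreasing b →
  ∀ y z → toℕ y ≤ toℕ z → degB G z ≤ degB G y
degB-antitone (_ , realB) b↓ y z y≤z = subst₂ _≤_ (sym (realB z)) (sym (realB y)) (b↓ y z y≤z)

module SwapCols {n m} {a : Vec ℕ n} {b : Vec ℕ m} {ν : ℕ} {inA : Fin ν → Bool} (a↓ : Nonincreasing a)
  (b↓ : Nonincreasing b) (S : CoveredMatching a b ν inA) (s t : Fin ν) (same-side : inA s ≡ inA t)
  (x<u : toℕ (row S s) < toℕ (row S t)) (y<z : toℕ (col S s) < toℕ (col S t)) where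
  x u : Fin n
  x = row S s
  u = row S t

  y z : Fin m
  y = col S s
  z = col S t

  x≢u : x ≢ u
  x≢u = <⇒≢ x<u

  y≢z : y ≢ z
  y≢z = <⇒≢ y<z

  col′ : Fin ν → Fin m
  col′ = col S ∘ transpose s t

  Covers : Fin n → Fin m → Set
  Covers i j = (Σ (Fin ν) λ r → inA r ≡ true × row S r ≡ i) ⊎ (Σ (Fin ν) λ r → inA r ≡ false × col′ r ≡ j)

  old-covered : ∀ i j → G S i j ≡ true → Covers i j
  old-covered i j e with covered S i j e
  ... | inj₁ by-row = inj₁ by-row
  ... | inj₂ (r , inAr , eq) = inj₂ (transpose t s r , trans (transpose-preserves t s inA (sym same-side) r) inAr ,
                                      trans (cong (col S) (transpose-inverse s t)) eq)

  xz-covered : Covers x z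
  xz-covered with inA s in inAs
  ... | true  = inj₁ (s , inAs , refl)
  ... | false = inj₂ (s , inAs , cong (col S) (transpose-here s t))

  uy-covered : Covers u y
  uy-covered with inA t in inAt
  ... | true  = inj₁ (t , inAt , refl)
  ... | false = inj₂ (t , inAt , cong (col S) (transpose-there s t))

  Swapped : Set
  Swapped = Σ (CoveredMatching a b ν inA) λ S′ → (∀ r → row S′ r ≡ row S r) × (∀ r → col S′ r ≡ col′ r)

  build : (G′ : BipGraph n m) → SameDegrees (G S) G′ → G′ x z ≡ true → G′ u y ≡ true →
    (∀ r → r ≢ s → r ≢ t → G′ (row S r) (col S r) ≡ true) → (∀ i j → G′ i j ≡ true → Covers i j) → Swapped
  build G′ same xz uy others covers = record
    { G = G′ ; row = row S ; col = col′ ; realizes = realizes-sameDegrees {a = a} {b = b} same (realizes S)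
    ; row-inj = row-inj S ; col-inj = transpose-injective s t ∘ col-inj S ; matched = matched′ ; covered = covers }
    , (λ _ → refl) , (λ _ → refl)
    where
    matched′ : ∀ r → G′ (row S r) (col′ r) ≡ true
    matched′ r with eitherOrNeither s t r
    ... | inj₁ refl               = subst (λ j → G′ x j ≡ true) (sym (cong (col S) (transpose-here s t))) xz
    ... | inj₂ (inj₁ refl)        = subst (λ j → G′ u j ≡ true) (sym (cong (col S) (transpose-there s t))) uy
    ... | inj₂ (inj₂ (r≢s , r≢t)) = subst (λ j → G′ (row S r) j ≡ true)
                                      (sym (cong (col S) (transpose-other s t r r≢s r≢t)))
                                      (others r r≢s r≢t)

  whenPresent : G S x z ≡ true → G S u y ≡ true → Swapped
  whenPresent xz uy = build (G S) ((λ _ → refl) , (λ _ → refl)) xz uy (λ r _ _ → matched S r) old-covered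

  whenAbsent : G S x z ≡ false → G S u y ≡ false → Swapped
  whenAbsent xz uy = build G′ sameDegrees′ switched-pd switched-qc others covers
    where
    open TwoSwitch (G S) x u y z x≢u y≢z (matched S s) xz uy (matched S t)
    others : ∀ r → r ≢ s → r ≢ t → G′ (row S r) (col S r) ≡ true
    others r r≢s r≢t = kept (row S r) (col S r) (matched S r) (r≢s ∘ row-inj S ∘ proj₁) (r≢t ∘ row-inj S ∘ proj₁)
    covers : ∀ i j → G′ i j ≡ true → Covers i j
    covers i j e with edge-cases i j e
    ... | inj₁ Gij                  = old-covered i j Gij
    ... | inj₂ (inj₁ (refl , refl)) = xz-covered
    ... | inj₂ (inj₂ (refl , refl)) = uy-covered

  -- Row x, having at least the degree of u, has a neighbour c that u lacks; switch along x c, u z.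
  whenOnlyUY : G S x z ≡ false → G S u y ≡ true → Swapped
  whenOnlyUY xz uy = build G′ sameDegrees′ switched-pd u-y others covers
    where
    extra : Σ (Fin m) λ c → G S x c ≡ true × G S u c ≡ false
    extra = surplus-witness (G S x) (G S u) z (degA-antitone {a = a} {b = b} (realizes S) a↓ x u (NP.<⇒≤ x<u))
              (matched S t) xz
    c : Fin m
    c = proj₁ extra
    xc : G S x c ≡ true
    xc = proj₁ (proj₂ extra)
    uc : G S u c ≡ false
    uc = proj₂ (proj₂ extra)
    c≢z : c ≢ z
    c≢z c≡z = true≢false (trans (sym xc) (trans (cong (G S x) c≡z) xz))
    open TwoSwitch (G S) x u c z x≢u c≢z xc xz uc (matched S t)
    u-y : G′ u y ≡ true
    u-y = kept u y uy (x≢u ∘ sym ∘ proj₁) (y≢z ∘ proj₂)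
    others : ∀ r → r ≢ s → r ≢ t → G′ (row S r) (col S r) ≡ true
    others r r≢s r≢t = kept (row S r) (col S r) (matched S r) (r≢s ∘ row-inj S ∘ proj₁) (r≢t ∘ row-inj S ∘ proj₁)
    uc-covered : Covers u c
    uc-covered with inA t in inAt | old-covered x c xc
    ... | true  | _          = inj₁ (t , inAt , refl)
    ... | false | inj₂ by-col = inj₂ by-col
    ... | false | inj₁ (r , inAr , eq) with row-inj S eq
    ...   | refl = ⊥-elim (true≢false (trans (sym inAr) (trans same-side inAt)))
    covers : ∀ i j → G′ i j ≡ true → Covers i j
    covers i j e with edge-cases i j e
    ... | inj₁ Gij                  = old-covered i j Gij
    ... | inj₂ (inj₁ (refl , refl)) = xz-covered
    ... | inj₂ (inj₂ (refl , refl)) = uc-covered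

  -- Column y, having at least the degree of z, has a neighbour r₀ that z lacks; switch along u z, r₀ y.
  whenOnlyXZ : G S x z ≡ true → G S u y ≡ false → Swapped
  whenOnlyXZ xz uy = build G′ sameDegrees′ x-z switched-pd others covers
    where
    extra : Σ (Fin n) λ r → G S r y ≡ true × G S r z ≡ false
    extra = surplus-witness (λ i → G S i y) (λ i → G S i z) u
              (degB-antitone {a = a} {b = b} (realizes S) b↓ y z (NP.<⇒≤ y<z)) (matched S t) uy
    r₀ : Fin n
    r₀ = proj₁ extra
    r₀y : G S r₀ y ≡ true
    r₀y = proj₁ (proj₂ extra)
    r₀z : G S r₀ z ≡ false
    r₀z = proj₂ (proj₂ extra)
    u≢r₀ : u ≢ r₀
    u≢r₀ u≡r₀ = true≢false (trans (sym (matched S t)) (trans (cong (λ i → G S i z) u≡r₀) r₀z))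
    open TwoSwitch (G S) u r₀ z y u≢r₀ (y≢z ∘ sym) (matched S t) uy r₀z r₀y
    x-z : G′ x z ≡ true
    x-z = kept x z xz (x≢u ∘ proj₁) (y≢z ∘ sym ∘ proj₂)
    others : ∀ r → r ≢ s → r ≢ t → G′ (row S r) (col S r) ≡ true
    others r r≢s r≢t = kept (row S r) (col S r) (matched S r) (r≢t ∘ row-inj S ∘ proj₁) (r≢s ∘ col-inj S ∘ proj₂)
    r₀z-covered : Covers r₀ z
    r₀z-covered with inA s in inAs | covered S r₀ y r₀y
    ... | false | _           = inj₂ (s , inAs , cong (col S) (transpose-here s t))
    ... | true  | inj₁ by-row = inj₁ by-row
    ... | true  | inj₂ (r , inAr , eq) with col-inj S eq
    ...   | refl = ⊥-elim (true≢false (trans (sym inAs) inAr))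
    covers : ∀ i j → G′ i j ≡ true → Covers i j
    covers i j e with edge-cases i j e
    ... | inj₁ Gij                  = old-covered i j Gij
    ... | inj₂ (inj₁ (refl , refl)) = uy-covered
    ... | inj₂ (inj₂ (refl , refl)) = r₀z-covered

  result : Swapped
  result with G S x z in xz | G S u y in uy
  ... | true  | true  = whenPresent xz uy
  ... | false | false = whenAbsent xz uy
  ... | false | true  = whenOnlyUY xz uy
  ... | true  | false = whenOnlyXZ xz uy

swapCols : ∀ {n m} {a : Vec ℕ n} {b : Vec ℕ m} {ν} {inA : Fin ν → Bool} → Nonincreasing a → Nonincreasing b →
  (S : CoveredMatching a b ν inA) (s t : Fin ν) → inA s ≡ inA t → toℕ (row S s) < toℕ (row S t) →
  toℕ (col S s) < toℕ (col S t) →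
  Σ (CoveredMatching a b ν inA) λ S′ → (∀ r → row S′ r ≡ row S r) × (∀ r → col S′ r ≡ col S (transpose s t r))
swapCols = SwapCols.result

moveCol : ∀ {n m} {a : Vec ℕ n} {b : Vec ℕ m} {ν} {inA : Fin ν → Bool} → Nonincreasing b →
  (S : CoveredMatching a b ν inA) (t : Fin ν) (y : Fin m) → (∀ s → col S s ≢ y) → toℕ y < toℕ (col S t) →
  Σ (CoveredMatching a b ν inA) λ S′ →
    col S′ t ≡ y × (∀ s → s ≢ t → col S′ s ≡ col S s) × (∀ s → row S′ s ≡ row S s)
moveCol {inA = inA} b↓ S t y y-free y<z with moveRow b↓ (transposeCM {inB = not ∘ inA} (λ _ → refl) S) t y y-free y<z
... | S′ , moved , others , same = transposeCM (λ r → sym (BP.not-involutive (inA r))) S′ , moved , others , same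

swapColsAcross : ∀ {n m} {a : Vec ℕ n} {b : Vec ℕ m} {ν} {inA : Fin ν → Bool} → Nonincreasing b →
  (S : CoveredMatching a b ν inA) (s t : Fin ν) → inA s ≡ false → inA t ≡ true → toℕ (col S t) < toℕ (col S s) →
  Σ (CoveredMatching a b ν inA) λ S′ → col S′ s ≡ col S t × col S′ t ≡ col S s ×
    (∀ r → r ≢ s → r ≢ t → col S′ r ≡ col S r) × (∀ r → row S′ r ≡ row S r)
swapColsAcross {inA = inA} b↓ S s t inA-s inA-t z<y
  with swapRowsAcross b↓ (transposeCM {inB = not ∘ inA} (λ _ → refl) S) s t (cong not inA-s) (cong not inA-t) z<y
... | S′ , p , q , others , same = transposeCM (λ r → sym (BP.not-involutive (inA r))) S′ , p , q , others , same

-- The edges of M meeting the tight cover, listed A-side first: the t-th vertex of coverA with its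
-- partner, then the partner of the t-th vertex of coverB with that vertex.
module FromTightCover {n m} {a : Vec ℕ n} {b : Vec ℕ m} (H : BipGraph n m) (realH : Realizes H a b)
  (M : EdgeSet n m) (isM : IsMatching H M) (C : TightCover H M) where
  open TightCover C

  kA kB : ℕ
  kA = count coverA
  kB = count coverB

  partnerA : Fin kA → Fin m
  partnerA t = proj₁ (coverA-matched (enumerate coverA t) (enumerate-sound coverA t))

  partnerB : Fin kB → Fin n
  partnerB t = proj₁ (coverB-matched (enumerate coverB t) (enumerate-sound coverB t))

  row⊎ : Fin kA ⊎ Fin kB → Fin n
  row⊎ (inj₁ t) = enumerate coverA t
  row⊎ (inj₂ t) = partnerB t

  col⊎ : Fin kA ⊎ Fin kB → Fin m
  col⊎ (inj₁ t) = partnerA t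
  col⊎ (inj₂ t) = enumerate coverB t

  M-row⊎-col⊎ : ∀ e → M (row⊎ e) (col⊎ e) ≡ true
  M-row⊎-col⊎ (inj₁ t) = proj₁ (proj₂ (coverA-matched (enumerate coverA t) (enumerate-sound coverA t)))
  M-row⊎-col⊎ (inj₂ t) = proj₁ (proj₂ (coverB-matched (enumerate coverB t) (enumerate-sound coverB t)))

  partnerB∉ : ∀ t → coverA (partnerB t) ≡ false
  partnerB∉ t = proj₂ (proj₂ (coverB-matched (enumerate coverB t) (enumerate-sound coverB t)))

  partnerA∉ : ∀ t → coverB (partnerA t) ≡ false
  partnerA∉ t = proj₂ (proj₂ (coverA-matched (enumerate coverA t) (enumerate-sound coverA t)))

  row⊎-inj : ∀ {e e′} → row⊎ e ≡ row⊎ e′ → e ≡ e′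
  row⊎-inj {inj₁ s} {inj₁ t} eq = cong inj₁ (enumerate-injective coverA eq)
  row⊎-inj {inj₁ s} {inj₂ t} eq = ⊥-elim (apart coverA (enumerate-sound coverA s) (partnerB∉ t) eq)
  row⊎-inj {inj₂ s} {inj₁ t} eq = ⊥-elim (apart coverA (enumerate-sound coverA t) (partnerB∉ s) (sym eq))
  row⊎-inj {inj₂ s} {inj₂ t} eq = cong inj₂ (enumerate-injective coverB
    (proj₁ (proj₂ isM) _ _ _ (M-row⊎-col⊎ (inj₂ s))
      (subst (λ i → M i (col⊎ (inj₂ t)) ≡ true) (sym eq) (M-row⊎-col⊎ (inj₂ t)))))

  col⊎-inj : ∀ {e e′} → col⊎ e ≡ col⊎ e′ → e ≡ e′
  col⊎-inj {inj₂ s} {inj₂ t} eq = cong inj₂ (enumerate-injective coverB eq)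
  col⊎-inj {inj₂ s} {inj₁ t} eq = ⊥-elim (apart coverB (enumerate-sound coverB s) (partnerA∉ t) eq)
  col⊎-inj {inj₁ s} {inj₂ t} eq = ⊥-elim (apart coverB (enumerate-sound coverB t) (partnerA∉ s) (sym eq))
  col⊎-inj {inj₁ s} {inj₁ t} eq = cong inj₁ (enumerate-injective coverA
    (proj₂ (proj₂ isM) _ _ _ (M-row⊎-col⊎ (inj₁ s))
      (subst (λ j → M (row⊎ (inj₁ t)) j ≡ true) (sym eq) (M-row⊎-col⊎ (inj₁ t)))))

  splitAt-inj : ∀ {s t : Fin (kA + kB)} → splitAt kA s ≡ splitAt kA t → s ≡ t
  splitAt-inj {s} {t} eq =
    trans (sym (FP.join-splitAt kA kB s)) (trans (cong (join kA kB) eq) (FP.join-splitAt kA kB t))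

  covered₀ : ∀ i j → H i j ≡ true →
    (Σ (Fin (kA + kB)) λ t → prefixSet kA t ≡ true × row⊎ (splitAt kA t) ≡ i) ⊎
    (Σ (Fin (kA + kB)) λ t → prefixSet kA t ≡ false × col⊎ (splitAt kA t) ≡ j)
  covered₀ i j Hij with isCover i j Hij
  ... | inj₁ i∈ = let (t , eq) = enumerate-complete coverA i i∈ in
    inj₁ (t ↑ˡ kB , <⇒prefixSet kA (t ↑ˡ kB) (subst (_< kA) (sym (FP.toℕ-↑ˡ t kB)) (FP.toℕ<n t)) ,
          trans (cong row⊎ (FP.splitAt-↑ˡ kA t kB)) eq)
  ... | inj₂ j∈ = let (t , eq) = enumerate-complete coverB j j∈ in
    inj₂ (kA ↑ʳ t , ≥⇒prefixSet-false kA (kA ↑ʳ t) (subst (kA ≤_) (sym (FP.toℕ-↑ʳ kA t)) (NP.m≤m+n kA (toℕ t))) ,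
          trans (cong col⊎ (FP.splitAt-↑ʳ kA kB t)) eq)

  initial : CoveredMatching a b (kA + kB) (prefixSet kA)
  initial = record
    { G = H ; row = row⊎ ∘ splitAt kA ; col = col⊎ ∘ splitAt kA ; realizes = realH
    ; row-inj = splitAt-inj ∘ row⊎-inj ; col-inj = splitAt-inj ∘ col⊎-inj
    ; matched = λ t → proj₁ isM _ _ (M-row⊎-col⊎ (splitAt kA t)) ; covered = covered₀ }

-- Aligning a covered matching with the antidiagonal

AntiDiagonal : ∀ {n m} {a : Vec ℕ n} {b : Vec ℕ m} {ν} {inA : Fin ν → Bool} → CoveredMatching a b ν inA → Set
AntiDiagonal {ν = ν} S = (∀ r → toℕ (row S r) ≡ toℕ r) × (∀ r → toℕ (col S r) ≡ ν ∸ suc (toℕ r))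

AlignedBelow : ∀ {ν k} → ℕ → (Fin ν → Fin k) → Set
AlignedBelow p f = ∀ r → toℕ r < p → toℕ (f r) ≡ toℕ r

module _ {ν k} {f : Fin ν → Fin k} {p : ℕ} (aligned : AlignedBelow p f) where
  aligned⇒above : (∀ {r r′} → f r ≡ f r′ → r ≡ r′) → ∀ r → p ≤ toℕ r → p ≤ toℕ (f r)
  aligned⇒above f-inj r p≤r = NP.≮⇒≥ λ fr<p → NP.<⇒≱ (below fr<p) p≤r
    where
    below : toℕ (f r) < p → toℕ r < p
    below fr<p = subst (λ r′ → toℕ r′ < p) r′≡r r′<p
      where
      fr<ν : toℕ (f r) < ν
      fr<ν = NP.<-≤-trans fr<p (NP.≤-trans p≤r (NP.<⇒≤ (FP.toℕ<n r)))
      r′ : Fin ν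
      r′ = fromℕ< fr<ν
      r′<p : toℕ r′ < p
      r′<p = subst (_< p) (sym (FP.toℕ-fromℕ< fr<ν)) fr<p
      r′≡r : r′ ≡ r
      r′≡r = f-inj (FP.toℕ-injective (trans (aligned r′ r′<p) (FP.toℕ-fromℕ< fr<ν)))

  aligned-preimage : ∀ s → toℕ (f s) ≡ p → p ≤ toℕ s
  aligned-preimage s fs≡p = NP.≮⇒≥ λ s<p → NP.<-irrefl (trans (sym (aligned s s<p)) fs≡p) s<p

  extend-aligned : (p<ν : p < ν) {g : Fin ν → Fin k} → toℕ (g (fromℕ< p<ν)) ≡ p →
    (∀ r → toℕ r < p → g r ≡ f r) → AlignedBelow (suc p) g
  extend-aligned p<ν {g} g-new g-old r r<1+p with NP.m<1+n⇒m<n∨m≡n r<1+p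
  ... | inj₁ r<p = trans (cong toℕ (g-old r r<p)) (aligned r r<p)
  ... | inj₂ r≡p with FP.toℕ-injective (trans r≡p (sym (FP.toℕ-fromℕ< p<ν)))
  ...   | refl = trans g-new (sym r≡p)

opposite-reverses : ∀ {ν} (s t : Fin ν) → toℕ (opposite t) < toℕ (opposite s) → toℕ s < toℕ t
opposite-reverses {ν} s t lt = NP.≰⇒> λ t≤s → NP.<⇒≱ lt
  (subst₂ _≤_ (sym (FP.opposite-prop s)) (sym (FP.opposite-prop t)) (NP.∸-monoʳ-≤ ν (s≤s t≤s)))

opposite-injective : ∀ {ν} {s t : Fin ν} → opposite s ≡ opposite t → s ≡ t
opposite-injective {s = s} {t} eq =
  trans (sym (FP.opposite-involutive s)) (trans (cong opposite eq) (FP.opposite-involutive t))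

module Align {n m} {a : Vec ℕ n} {b : Vec ℕ m} {ν : ℕ} (k : ℕ) (a↓ : Nonincreasing a) (b↓ : Nonincreasing b) where
  CM : Set
  CM = CoveredMatching a b ν (prefixSet k)

  module RowStep (p : ℕ) (p<ν : p < ν) (S : CM) (aligned : AlignedBelow p (row S)) where
    t : Fin ν
    t = fromℕ< p<ν

    p<n : p < n
    p<n = NP.<-≤-trans p<ν (FP.injective⇒≤ (row-inj S))

    x : Fin n
    x = fromℕ< p<n

    below≢t : ∀ r → toℕ r < p → r ≢ t
    below≢t r r<p refl = NP.<-irrefl (FP.toℕ-fromℕ< p<ν) r<p

    x<row : ∀ r → toℕ r ≡ p → row S r ≢ x → toℕ x < toℕ (row S r)
    x<row r r≡p r≢x = subst (_< toℕ (row S r)) (sym (FP.toℕ-fromℕ< p<n))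
      (NP.≤∧≢⇒< (aligned⇒above aligned (row-inj S) r (NP.≤-reflexive (sym r≡p)))
                 (λ p≡r → r≢x (FP.toℕ-injective (trans (sym p≡r) (sym (FP.toℕ-fromℕ< p<n))))))

    Result : Set
    Result = Σ CM λ S′ → AlignedBelow (suc p) (row S′)

    finish : (S′ : CM) → row S′ t ≡ x → (∀ r → toℕ r < p → row S′ r ≡ row S r) → Result
    finish S′ new old = S′ , extend-aligned aligned p<ν (trans (cong toℕ new) (FP.toℕ-fromℕ< p<n)) old

    whenFree : (∀ s → row S s ≢ x) → Result
    whenFree x-free with moveRow a↓ S t x x-free (x<row t (FP.toℕ-fromℕ< p<ν) (x-free t))
    ... | S′ , moved , others , _ = finish S′ moved (λ r r<p → others r (below≢t r r<p))

    module Taken (s : Fin ν) (rs≡x : row S s ≡ x) (s≢t : s ≢ t) where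
      p<s : p < toℕ s
      p<s = NP.≤∧≢⇒< (aligned-preimage aligned s (trans (cong toℕ rs≡x) (FP.toℕ-fromℕ< p<n)))
              (λ p≡s → s≢t (FP.toℕ-injective (trans (sym p≡s) (sym (FP.toℕ-fromℕ< p<ν)))))

      below≢s : ∀ r → toℕ r < p → r ≢ s
      below≢s r r<p refl = NP.<-asym r<p p<s

      sameSide : prefixSet k s ≡ prefixSet k t → Result
      sameSide same with relabel S s t same
      ... | S′ , row′ , _ = finish S′ (trans (row′ t) (trans (cong (row S) (transpose-there s t)) rs≡x))
        (λ r r<p → trans (row′ r) (cong (row S) (transpose-other s t r (below≢s r r<p) (below≢t r r<p))))

      otherSide : prefixSet k t ≡ true → prefixSet k s ≡ false → Result
      otherSide inA-t inA-s with swapRowsAcross a↓ S t s inA-t inA-s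
                                   (subst (_< toℕ (row S t)) (cong toℕ (sym rs≡x))
                                     (x<row t (FP.toℕ-fromℕ< p<ν) λ rt≡x → s≢t (row-inj S (trans rs≡x (sym rt≡x)))))
      ... | S′ , new , _ , others , _ = finish S′ (trans new rs≡x) (λ r r<p → others r (below≢t r r<p) (below≢s r r<p))

      result : Result
      result with prefixSet k s ≟ prefixSet k t
      ... | yes same  = sameSide same
      ... | no differ = let (inA-t , inA-s) = prefix-order k t s (subst (_< toℕ s) (sym (FP.toℕ-fromℕ< p<ν)) p<s)
                                                 (differ ∘ sym)
                        in otherSide inA-t inA-s

    result : Result
    result with FP.any? (λ r → row S r FP.≟ x)
    ... | no none = whenFree (λ s rs≡x → none (s , rs≡x))
    ... | yes (s , rs≡x) with s FP.≟ t
    ...   | yes refl = finish S rs≡x (λ _ _ → refl)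
    ...   | no s≢t   = Taken.result s rs≡x s≢t

  alignRows : ∀ p → p ≤ ν → CM → Σ CM λ S → AlignedBelow p (row S)
  alignRows zero    _   S = S , λ _ ()
  alignRows (suc p) p<ν S with alignRows p (NP.<⇒≤ p<ν) S
  ... | S′ , aligned = RowStep.result p p<ν S′ aligned

  -- Columns are aligned from the last label down, via the order-reversing relabelling opposite.
  module ColStep (d : ℕ) (d<ν : d < ν) (S : CM) (rows : AlignedBelow ν (row S))
                 (aligned : AlignedBelow d (col S ∘ opposite)) where
    t′ : Fin ν
    t′ = fromℕ< d<ν

    t : Fin ν
    t = opposite t′

    d<m : d < m
    d<m = NP.<-≤-trans d<ν (FP.injective⇒≤ (col-inj S))

    c : Fin m
    c = fromℕ< d<m

    col∘opposite-inj : ∀ {r r′} → col S (opposite r) ≡ col S (opposite r′) → r ≡ r′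
    col∘opposite-inj = opposite-injective ∘ col-inj S

    below≢t : ∀ r → toℕ r < d → opposite r ≢ t
    below≢t r r<d eq with opposite-injective eq
    ... | refl = NP.<-irrefl (FP.toℕ-fromℕ< d<ν) r<d

    c<col-t : col S t ≢ c → toℕ c < toℕ (col S t)
    c<col-t ct≢c = subst (_< toℕ (col S t)) (sym (FP.toℕ-fromℕ< d<m))
      (NP.≤∧≢⇒< (aligned⇒above aligned col∘opposite-inj t′ (NP.≤-reflexive (sym (FP.toℕ-fromℕ< d<ν))))
                 (λ d≡ → ct≢c (FP.toℕ-injective (trans (sym d≡) (sym (FP.toℕ-fromℕ< d<m))))))

    Result : Set
    Result = Σ CM λ S′ → AlignedBelow ν (row S′) × AlignedBelow (suc d) (col S′ ∘ opposite)

    finish : (S′ : CM) → (∀ r → row S′ r ≡ row S r) → col S′ t ≡ c →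
      (∀ r → opposite r ≢ t → toℕ r < d → col S′ (opposite r) ≡ col S (opposite r)) → Result
    finish S′ same-rows new old = S′ , (λ r r<ν → trans (cong toℕ (same-rows r)) (rows r r<ν)) ,
      extend-aligned aligned d<ν (trans (cong toℕ new) (FP.toℕ-fromℕ< d<m)) (λ r r<d → old r (below≢t r r<d) r<d)

    whenFree : (∀ s → col S s ≢ c) → Result
    whenFree c-free with moveCol b↓ S t c c-free (c<col-t (c-free t))
    ... | S′ , moved , others , same-rows = finish S′ same-rows moved (λ r r≢t _ → others (opposite r) r≢t)

    module Taken (s : Fin ν) (cs≡c : col S s ≡ c) (s≢t : s ≢ t) where
      d<s′ : d < toℕ (opposite s)
      d<s′ = NP.≤∧≢⇒<
        (aligned-preimage aligned (opposite s)
          (trans (cong (toℕ ∘ col S) (FP.opposite-involutive s)) (trans (cong toℕ cs≡c) (FP.toℕ-fromℕ< d<m))))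
        (λ d≡ → s≢t (trans (sym (FP.opposite-involutive s))
                      (cong opposite (FP.toℕ-injective (trans (sym d≡) (sym (FP.toℕ-fromℕ< d<ν)))))))

      s<t : toℕ s < toℕ t
      s<t = opposite-reverses s t (subst (_< toℕ (opposite s))
              (sym (trans (cong toℕ (FP.opposite-involutive t′)) (FP.toℕ-fromℕ< d<ν))) d<s′)

      below≢s : ∀ r → toℕ r < d → opposite r ≢ s
      below≢s r r<d refl = NP.<-asym r<d (subst (λ r′ → d < toℕ r′) (FP.opposite-involutive r) d<s′)

      rows< : toℕ (row S s) < toℕ (row S t)
      rows< = subst₂ _<_ (sym (rows s (FP.toℕ<n s))) (sym (rows t (FP.toℕ<n t))) s<t

      cols< : toℕ (col S s) < toℕ (col S t)
      cols< = subst (_< toℕ (col S t)) (cong toℕ (sym cs≡c))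
                (c<col-t λ ct≡c → s≢t (col-inj S (trans cs≡c (sym ct≡c))))

      sameSide : prefixSet k s ≡ prefixSet k t → Result
      sameSide same with swapCols a↓ b↓ S s t same rows< cols<
      ... | S′ , same-rows , col′ = finish S′ same-rows (trans (col′ t) (trans (cong (col S) (transpose-there s t)) cs≡c))
        (λ r r≢t r<d → trans (col′ (opposite r)) (cong (col S) (transpose-other s t (opposite r) (below≢s r r<d) r≢t)))

      otherSide : prefixSet k s ≡ true → prefixSet k t ≡ false → Result
      otherSide inA-s inA-t with swapColsAcross b↓ S t s inA-t inA-s cols<
      ... | S′ , new , _ , others , same-rows = finish S′ same-rows (trans new cs≡c)
        (λ r r≢t r<d → others (opposite r) r≢t (below≢s r r<d))

      result : Result
      result with prefixSet k s ≟ prefixSet k t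
      ... | yes same  = sameSide same
      ... | no differ = let (inA-s , inA-t) = prefix-order k s t s<t differ in otherSide inA-s inA-t

    result : Result
    result with FP.any? (λ r → col S r FP.≟ c)
    ... | no none = whenFree (λ s cs≡c → none (s , cs≡c))
    ... | yes (s , cs≡c) with s FP.≟ t
    ...   | yes refl = finish S (λ _ → refl) cs≡c (λ _ _ _ → refl)
    ...   | no s≢t   = Taken.result s cs≡c s≢t

  alignCols : ∀ d → d ≤ ν → (S : CM) → AlignedBelow ν (row S) →
    Σ CM λ S′ → AlignedBelow ν (row S′) × AlignedBelow d (col S′ ∘ opposite)
  alignCols zero    _   S rows = S , rows , λ _ ()
  alignCols (suc d) d<ν S rows with alignCols d (NP.<⇒≤ d<ν) S rows
  ... | S′ , rows′ , aligned = ColStep.result d d<ν S′ rows′ aligned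

  align : CM → Σ CM AntiDiagonal
  align S₀ with alignRows ν NP.≤-refl S₀
  ... | S₁ , rows with alignCols ν NP.≤-refl S₁ rows
  ...   | S₂ , rows′ , cols = S₂ , (λ r → rows′ r (FP.toℕ<n r)) , λ r →
          trans (cong (toℕ ∘ col S₂) (sym (FP.opposite-involutive r)))
                (trans (cols (opposite r) (FP.toℕ<n (opposite r))) (FP.opposite-prop r))

-- The antidiagonal matching and the prefix cover

module _ {n m} (ν : ℕ) (i : Fin n) (j : Fin m) where
  private
    +1≡suc : toℕ i + toℕ j + 1 ≡ suc (toℕ i) + toℕ j
    +1≡suc = NP.+-comm (toℕ i + toℕ j) 1

  antiDiag-elim : antiDiagMatching ν i j ≡ true → toℕ i < ν × toℕ j ≡ ν ∸ suc (toℕ i)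
  antiDiag-elim e with toℕ i <ᵇ ν in i<ν | (toℕ i + toℕ j + 1) ≡ᵇ ν in on-diag
  ... | true | true = NP.<ᵇ⇒< _ _ (subst T (sym i<ν) _) ,
    trans (sym (NP.m+n∸m≡n (suc (toℕ i)) (toℕ j)))
          (cong (_∸ suc (toℕ i)) (trans (sym +1≡suc) (NP.≡ᵇ⇒≡ _ _ (subst T (sym on-diag) _))))

  antiDiag-intro : toℕ i < ν → toℕ j ≡ ν ∸ suc (toℕ i) → antiDiagMatching ν i j ≡ true
  antiDiag-intro i<ν j≡ with toℕ i <ᵇ ν in lt | (toℕ i + toℕ j + 1) ≡ᵇ ν in on-diag
  ... | true  | true  = refl
  ... | false | _     = ⊥-elim (subst T lt (NP.<⇒<ᵇ i<ν))
  ... | true  | false = ⊥-elim (subst T on-diag (NP.≡⇒≡ᵇ _ _ (begin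
    toℕ i + toℕ j + 1               ≡⟨ +1≡suc ⟩
    suc (toℕ i) + toℕ j             ≡⟨ cong (suc (toℕ i) +_) j≡ ⟩
    suc (toℕ i) + (ν ∸ suc (toℕ i)) ≡⟨ NP.m+[n∸m]≡n i<ν ⟩
    ν                               ∎)))
    where open ≡-Reasoning

  antiDiag-outside : ν ≤ toℕ i → antiDiagMatching ν i j ≡ false
  antiDiag-outside ν≤i with toℕ i <ᵇ ν in lt
  ... | false = refl
  ... | true  = ⊥-elim (NP.<⇒≱ (NP.<ᵇ⇒< _ _ (subst T (sym lt) _)) ν≤i)

size-antiDiag : ∀ {n m} ν → ν ≤ n → ν ≤ m → size {n} {m} (antiDiagMatching ν) ≡ ν
size-antiDiag {n} {m} ν ν≤n ν≤m = begin
  sumF (λ i → count (antiDiagMatching {n} {m} ν i)) ≡⟨ sumF-cong row-count ⟩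
  sumF (bit ∘ prefixSet {n} ν)                 ≡⟨ count≡sumF (prefixSet {n} ν) ⟨
  count (prefixSet {n} ν)                      ≡⟨ count-prefix ν ν≤n ⟩
  ν                                            ∎
  where
  open ≡-Reasoning
  row-count : ∀ i → count (antiDiagMatching {n} {m} ν i) ≡ bit (prefixSet ν i)
  row-count i with toℕ i NP.<? ν
  ... | no ν≰i  = trans (count-cong {m} λ j → antiDiag-outside ν i j (NP.≮⇒≥ ν≰i))
                    (trans (count-false {m}) (cong bit (sym (≥⇒prefixSet-false ν i (NP.≮⇒≥ ν≰i)))))
  ... | yes i<ν = trans (count-unique _ j₀ (antiDiag-intro ν i j₀ i<ν (FP.toℕ-fromℕ< _)) others)
                    (cong bit (sym (<⇒prefixSet ν i i<ν)))
    where
    j₀ : Fin m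
    j₀ = fromℕ< (NP.<-≤-trans (NP.∸-monoʳ-< (s≤s z≤n) i<ν) ν≤m)
    others : ∀ j → j ≢ j₀ → antiDiagMatching ν i j ≡ false
    others j j≢j₀ with antiDiagMatching ν i j in e
    ... | false = refl
    ... | true  = ⊥-elim (j≢j₀ (FP.toℕ-injective (trans (proj₂ (antiDiag-elim ν i j e)) (sym (FP.toℕ-fromℕ< _)))))

optimal-pair : ∀ {n m} {G : BipGraph n m} {M : EdgeSet n m} {CA CB} → IsMatching G M → IsVertexCover G CA CB →
  size M ≡ count CA + count CB → IsMaximumMatching G M × IsMinimumVertexCover G CA CB
optimal-pair {G = G} {M} {CA} {CB} isM isC M≡C =
  (isM , λ M′ isM′ → NP.≤-trans (matching≤cover G M′ CA CB isM′ isC) (NP.≤-reflexive (sym M≡C))) ,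
  (isC , λ CA′ CB′ isC′ → NP.≤-trans (NP.≤-reflexive (sym M≡C)) (matching≤cover G M CA′ CB′ isM isC′))

NormalForm : ∀ {n m} → Vec ℕ n → Vec ℕ m → ℕ → Set
NormalForm {n} {m} a b ν = Σ (BipGraph n m) λ G → Σ ℕ λ k →
  Realizes G a b × k ≤ ν × IsMaximumMatching G (antiDiagMatching ν) ×
  IsMinimumVertexCover G (prefixSet k) (prefixSet (ν ∸ k))

module FromAntiDiagonal {n m} {a : Vec ℕ n} {b : Vec ℕ m} {ν : ℕ} (k : ℕ) (k≤ν : k ≤ ν)
  (S : CoveredMatching a b ν (prefixSet k)) (rows : ∀ r → toℕ (row S r) ≡ toℕ r)
  (cols : ∀ r → toℕ (col S r) ≡ ν ∸ suc (toℕ r)) where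
  ν≤n : ν ≤ n
  ν≤n = FP.injective⇒≤ (row-inj S)

  ν≤m : ν ≤ m
  ν≤m = FP.injective⇒≤ (col-inj S)

  antiDiag-isMatching : IsMatching (G S) (antiDiagMatching ν)
  antiDiag-isMatching = ⊆G , row-unique , col-unique
    where
    ⊆G : ∀ i j → antiDiagMatching ν i j ≡ true → G S i j ≡ true
    ⊆G i j e = subst₂ (λ i j → G S i j ≡ true) row-t col-t (matched S t)
      where
      i<ν : toℕ i < ν
      i<ν = proj₁ (antiDiag-elim ν i j e)
      t : Fin ν
      t = fromℕ< i<ν
      row-t : row S t ≡ i
      row-t = FP.toℕ-injective (trans (rows t) (FP.toℕ-fromℕ< i<ν))
      col-t : col S t ≡ j
      col-t = FP.toℕ-injective (trans (cols t)
                (trans (cong (λ x → ν ∸ suc x) (FP.toℕ-fromℕ< i<ν)) (sym (proj₂ (antiDiag-elim ν i j e)))))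
    row-unique : ∀ i j j′ → antiDiagMatching ν i j ≡ true → antiDiagMatching ν i j′ ≡ true → j ≡ j′
    row-unique i j j′ e e′ =
      FP.toℕ-injective (trans (proj₂ (antiDiag-elim ν i j e)) (sym (proj₂ (antiDiag-elim ν i j′ e′))))
    col-unique : ∀ i i′ j → antiDiagMatching ν i j ≡ true → antiDiagMatching ν i′ j ≡ true → i ≡ i′
    col-unique i i′ j e e′ =
      let (i<ν , j≡) = antiDiag-elim ν i j e ; (i′<ν , j≡′) = antiDiag-elim ν i′ j e′
      in FP.toℕ-injective (NP.suc-injective (NP.∸-cancelˡ-≡ i<ν i′<ν (trans (sym j≡) j≡′)))

  prefix-isCover : IsVertexCover (G S) (prefixSet k) (prefixSet (ν ∸ k))
  prefix-isCover i j e with covered S i j e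
  ... | inj₁ (t , inA-t , refl) = inj₁ (<⇒prefixSet k (row S t) (subst (_< k) (sym (rows t)) (prefixSet⇒< k t inA-t)))
  ... | inj₂ (t , inA-t , refl) = inj₂ (<⇒prefixSet (ν ∸ k) (col S t) (subst (_< ν ∸ k) (sym (cols t))
      (NP.∸-monoʳ-< (s≤s (prefixSet-false⇒≥ k t inA-t)) (FP.toℕ<n t))))

  size-prefixCover : count (prefixSet {n} k) + count (prefixSet {m} (ν ∸ k)) ≡ ν
  size-prefixCover = trans
    (cong₂ _+_ (count-prefix k (NP.≤-trans k≤ν ν≤n)) (count-prefix (ν ∸ k) (NP.≤-trans (NP.m∸n≤m ν k) ν≤m)))
    (NP.m+[n∸m]≡n k≤ν)

  normalForm : NormalForm a b ν
  normalForm = G S , k , realizes S , k≤ν ,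
    optimal-pair antiDiag-isMatching prefix-isCover (trans (size-antiDiag ν ν≤n ν≤m) (sym size-prefixCover))

antiDiagonal⇒normalForm : ∀ {n m} {a : Vec ℕ n} {b : Vec ℕ m} {ν} k → k ≤ ν →
  Σ (CoveredMatching a b ν (prefixSet k)) AntiDiagonal → NormalForm a b ν
antiDiagonal⇒normalForm k k≤ν (S , rows , cols) = FromAntiDiagonal.normalForm k k≤ν S rows cols

theorem2 : ∀ {n m} (a : Vec ℕ n) (b : Vec ℕ m) (ν : ℕ) →
    Nonincreasing a → Nonincreasing b →
    Σ (BipGraph n m) (λ H → Realizes H a b × HasMatchingNumber H ν) →
    Σ (BipGraph n m) (λ G → Σ ℕ (λ k →
      Realizes G a b × k ≤ ν ×
      IsMaximumMatching G (antiDiagMatching ν) ×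
      IsMinimumVertexCover G (prefixSet k) (prefixSet (ν ∸ k))))
theorem2 a b ν a↓ b↓ (H , realH , M , (isM , maxM) , size-M) =
  subst (NormalForm a b) (trans (TightCover.size-coverA+coverB C isM) size-M)
    (antiDiagonal⇒normalForm kA (NP.m≤m+n kA kB) (Align.align {a = a} {b = b} kA a↓ b↓ initial))
  where
  C : TightCover H M
  C = König.tightCover H M isM maxM
  open FromTightCover {a = a} {b = b} H realH M isM C
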